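{- Let $i,j,n\geq 0$ and let $L$ be a set of $n$ integers. There is a bijection between: - (i) alternative tableaux in $\mathcal{A}_{i,j}(n)$ labeled by $L$; and - (ii) pairs $(P,Q)$ of labeled alternative tableaux, where $P$ has exactly $i$ free rows and no free column, $Q$ has no free row and exactly $j$ free columns, and the label sets $L_P$ of $P$ and $L_Q$ of $Q$ satisfy $L_P\cap L_Q=\emptyset$ and $L_P\cup L_Q=L$.
   Context: A shape of length $n$ is a Ferrers diagram in English notation, possibly with empty rows or columns. It is determined by its south-east border, a path of $n$ unit south/west steps from the top-right corner to the bottom-left corner. South steps correspond to rows and west steps to columns. The shape is labeled by a set of integers $L=\{i_1<\dots<i_n\}$ if $i_1,\dots,i_n$ are attached to the rows and columns in the order in which their steps occur along the south-east border from top-right to bottom-left. An alternative tableau is a shape with a partial filling of cells by left arrows and up arrows such that every cell to the left of a left arrow in its row, and every cell above an up arrow in its column, is empty. A free row is a row with no left arrow; a free column is a column with no up arrow. $\mathcal{A}_{i,j}(n)$ is the set of alternative tableaux of length $n$ with exactly $i$ free rows and $j$ free columns. -}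

module Defs where

open import Data.Bool using (Bool; true; false; _∧_; _∨_; not; if_then_else_; T)
open import Data.Nat as ℕ using (ℕ; zero; suc)
open import Data.Fin using (Fin; toℕ)
open import Data.List using (List; []; _∷_; length; allFin; filter)
open import Data.Bool.ListAction using (all; any)
open import Data.Vec using (Vec; lookup)
open import Data.Integer using (ℤ)
import Data.Integer as ℤ
open import Relation.Nullary.Decidable using (⌊_⌋)
open import Data.Product using (Σ; _×_; _,_)

-- A shape of length n is its south-east border: a sequence of
-- n unit steps read from the top-right corner to the bottom-left corner.
-- true = south step (a row), false = west step (a column).

Shape : ℕ → Set
Shape n = Vec Bool n

isRow : ∀ {n} → Shape n → Fin n → Bool
isRow s p = lookup s p

isCol : ∀ {n} → Shape n → Fin n → Bool
isCol s q = not (lookup s q)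

_<ᵇ_ : ∀ {n} → Fin n → Fin n → Bool
p <ᵇ q = toℕ p ℕ.<ᵇ toℕ q

-- The row of step p and the column of step q meet in a cell of the
-- Ferrers diagram iff p is a row step, q is a column step, and the row
-- step occurs before the column step along the border.
isCell : ∀ {n} → Shape n → Fin n → Fin n → Bool
isCell s p q = isRow s p ∧ isCol s q ∧ (p <ᵇ q)

-- Fillings: each position (p , q) (row step p, column step q) carries
-- nothing, a left arrow or an up arrow.

data Arrow : Set where
  empty left up : Arrow

isEmpty isLeft isUp : Arrow → Bool
isEmpty empty = true
isEmpty _     = false
isLeft left = true
isLeft _    = false
isUp up = true
isUp _  = false

Filling : ℕ → Set
Filling n = Vec (Vec Arrow n) n

entry : ∀ {n} → Filling n → Fin n → Fin n → Arrow
entry F p q = lookup (lookup F p) q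

_⇒ᵇ_ : Bool → Bool → Bool
a ⇒ᵇ b = not a ∨ b

onlyCellsFilled : ∀ {n} → Shape n → Filling n → Bool
onlyCellsFilled {n} s F =
  all (λ p → all (λ q → not (isCell s p q) ⇒ᵇ isEmpty (entry F p q)) (allFin n)) (allFin n)

-- Every cell to the left of a left arrow (same row, a column step
-- occurring later along the border) is empty.
leftCondition : ∀ {n} → Shape n → Filling n → Bool
leftCondition {n} s F =
  all (λ p → all (λ q → all (λ q' →
    (isLeft (entry F p q) ∧ isCell s p q' ∧ (q <ᵇ q')) ⇒ᵇ isEmpty (entry F p q'))
    (allFin n)) (allFin n)) (allFin n)

-- Every cell above an up arrow (same column, a row step occurring
-- earlier along the border) is empty.
upCondition : ∀ {n} → Shape n → Filling n → Bool
upCondition {n} s F =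
  all (λ p → all (λ q → all (λ p' →
    (isUp (entry F p q) ∧ isCell s p' q ∧ (p' <ᵇ p)) ⇒ᵇ isEmpty (entry F p' q))
    (allFin n)) (allFin n)) (allFin n)

isAlternative : ∀ {n} → Shape n → Filling n → Bool
isAlternative s F = onlyCellsFilled s F ∧ leftCondition s F ∧ upCondition s F

-- An alternative tableau of length n (boolean validity, so that the
-- validity proof is unique).
record AltTableau (n : ℕ) : Set where
  constructor altTableau
  field
    shape   : Shape n
    filling : Filling n
    valid   : T (isAlternative shape filling)
open AltTableau public

countᵇ : ∀ {n} → (Fin n → Bool) → ℕ
countᵇ {n} P = length (filter (λ x → P x Data.Bool.≟ true) (allFin n))

freeRows : ∀ {n} → AltTableau n → ℕ
freeRows {n} t = countᵇ (λ p → isRow (shape t) p ∧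
  all (λ q → not (isLeft (entry (filling t) p q))) (allFin n))

freeCols : ∀ {n} → AltTableau n → ℕ
freeCols {n} t = countᵇ (λ q → isCol (shape t) q ∧
  all (λ p → not (isUp (entry (filling t) p q))) (allFin n))

-- Finite sets of integers, written as strictly increasing lists
-- (i₁ < ⋯ < iₙ).

strictlyIncreasing : List ℤ → Bool
strictlyIncreasing []           = true
strictlyIncreasing (x ∷ [])     = true
strictlyIncreasing (x ∷ y ∷ xs) = ⌊ x ℤ.<? y ⌋ ∧ strictlyIncreasing (y ∷ xs)

_∈ᵇ_ : ℤ → List ℤ → Bool
x ∈ᵇ xs = any (λ y → ⌊ x ℤ.≟ y ⌋) xs

-- A labeled alternative tableau: a label set L = {i₁ < ⋯ < iₙ} and an
-- alternative tableau of length n = |L|; the k-th label is attached to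
-- the k-th border step (from top-right to bottom-left).
record LabeledAltTableau : Set where
  constructor labeledAltTableau
  field
    labels     : List ℤ
    increasing : T (strictlyIncreasing labels)
    tableau    : AltTableau (length labels)
open LabeledAltTableau public

lFreeRows lFreeCols : LabeledAltTableau → ℕ
lFreeRows t = freeRows (tableau t)
lFreeCols t = freeCols (tableau t)

sameList : List ℤ → List ℤ → Bool
sameList []       []       = true
sameList (x ∷ xs) (y ∷ ys) = ⌊ x ℤ.≟ y ⌋ ∧ sameList xs ys
sameList _        _        = false

LabeledA : ℕ → ℕ → ℕ → List ℤ → Set
LabeledA i j n L =
  Σ LabeledAltTableau λ t →
    T (sameList (labels t) L ∧ ⌊ length (labels t) ℕ.≟ n ⌋
       ∧ ⌊ lFreeRows t ℕ.≟ i ⌋ ∧ ⌊ lFreeCols t ℕ.≟ j ⌋)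

disjointUnionᵇ : List ℤ → List ℤ → List ℤ → Bool
disjointUnionᵇ LP LQ L =
  all (λ x → not (x ∈ᵇ LQ)) LP
  ∧ all (λ x → x ∈ᵇ L) LP
  ∧ all (λ x → x ∈ᵇ L) LQ
  ∧ all (λ x → (x ∈ᵇ LP) ∨ (x ∈ᵇ LQ)) L

PairsPQ : ℕ → ℕ → List ℤ → Set
PairsPQ i j L =
  Σ (LabeledAltTableau × LabeledAltTableau) λ where
    (P , Q) → T ( ⌊ lFreeRows P ℕ.≟ i ⌋ ∧ ⌊ lFreeCols P ℕ.≟ 0 ⌋
                ∧ ⌊ lFreeRows Q ℕ.≟ 0 ⌋ ∧ ⌊ lFreeCols Q ℕ.≟ j ⌋
                ∧ disjointUnionᵇ (labels P) (labels Q) L )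

-- Colour the border steps of a tableau T: following from a row its
-- left arrow to a column and then that column's up arrow to a strictly
-- higher row, and so on, one ends in a free row (colour true) or a free
-- column (colour false).  This is the unique colouring that is constant
-- along arrows, true on free rows and false on free columns.  No arrow
-- joins the two colour classes, so T is the merge of its restrictions P
-- (true steps) and Q (false steps); conversely merging P and Q along any
-- mask gives back a tableau for which the mask is that colouring.
module Submission where

open import Defs
open import Data.Nat as ℕ using (ℕ; zero; suc; _+_; s≤s; z≤n)
open import Data.Integer using (ℤ)
import Data.Integer as ℤ
import Data.Integer.Properties as ℤP
open import Data.List using (List; []; _∷_; length; allFin; filter; tabulate)
open import Data.Bool using (Bool; true; false; T; _∧_; _∨_; not)
import Data.Bool as Bool
import Data.Bool.Properties as BoolP
open import Data.Bool.ListAction using (all)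
open import Data.Fin using (Fin; zero; suc; toℕ; _<_)
import Data.Fin.Properties as FinP
open import Data.Vec using (Vec; []; _∷_; lookup)
import Data.Vec as Vec
import Data.Vec.Properties as VecP
open import Data.Sum using (_⊎_; inj₁; inj₂)
import Data.Sum as Sum
open import Data.Product using (Σ; _×_; _,_; proj₁; proj₂)
open import Data.Unit using (tt)
open import Data.Maybe using (Maybe; just; nothing)
open import Data.Empty using (⊥-elim)
open import Function using (_∘_; id; Equivalence)
open import Function.Bundles using (_↔_; mk↔ₛ′)
open import Function.Properties.Inverse using (↔-refl)
open import Data.Product.Function.NonDependent.Propositional using (_×-↔_)
open import Data.Product.Function.Dependent.Propositional using (Σ-↔)
import Function.Related.Propositional as Related
open import Relation.Binary.PropositionalEquality
open import Relation.Binary using (tri<; tri≈; tri>)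
open import Relation.Nullary using (¬_; yes; no)
open import Relation.Nullary.Decidable using (T?; ⌊_⌋; toWitness; fromWitness)
open import Data.List.Membership.Propositional using (_∈_; _∉_)
open import Data.List.Relation.Unary.Any using (here; there)
open import Data.List.Relation.Unary.All using (All; []; _∷_)
import Data.List.Relation.Unary.All as All
import Data.List.Relation.Unary.All.Properties as AllP
open import Data.List.Relation.Unary.AllPairs using (AllPairs; []; _∷_)
open import Data.List.Relation.Unary.Linked using (Linked; []; [-]; _∷_)
import Data.List.Relation.Unary.Linked.Properties as LinkedP
import Data.Nat.Properties as ℕP

true≢false : true ≢ false
true≢false ()

T-ext : ∀ {a b} → (T a → T b) → (T b → T a) → a ≡ b
T-ext {false} {false} _ _ = refl
T-ext {false} {true}  _ g = ⊥-elim (g tt)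
T-ext {true}  {false} f _ = ⊥-elim (f tt)
T-ext {true}  {true}  _ _ = refl

false-if-not-T : ∀ {b} → ¬ T b → b ≡ false
false-if-not-T {false} _ = refl
false-if-not-T {true}  h = ⊥-elim (h tt)

T-not⇒¬ : ∀ {b} → T (not b) → ¬ T b
T-not⇒¬ {false} _ ()

¬⇒T-not : ∀ {b} → ¬ T b → T (not b)
¬⇒T-not {false} _ = tt
¬⇒T-not {true}  h = h tt

∧-fst : ∀ {a b} → T (a ∧ b) → T a
∧-fst = proj₁ ∘ Equivalence.to BoolP.T-∧

∧-snd : ∀ {a b} → T (a ∧ b) → T b
∧-snd {a} = proj₂ ∘ Equivalence.to (BoolP.T-∧ {a})

∧-intro : ∀ {a b} → T a → T b → T (a ∧ b)
∧-intro ta tb = Equivalence.from BoolP.T-∧ (ta , tb)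

left-nonempty : ∀ {a} → a ≡ left → a ≢ empty
left-nonempty refl ()

up-nonempty : ∀ {a} → a ≡ up → a ≢ empty
up-nonempty refl ()

trues falses : ∀ {n} → Vec Bool n → ℕ
trues []          = 0
trues (true ∷ m)  = suc (trues m)
trues (false ∷ m) = trues m
falses []          = 0
falses (true ∷ m)  = falses m
falses (false ∷ m) = suc (falses m)

trueAt : ∀ {n} (m : Vec Bool n) → Fin (trues m) → Fin n
trueAt (true ∷ m)  zero    = zero
trueAt (true ∷ m)  (suc a) = suc (trueAt m a)
trueAt (false ∷ m) a       = suc (trueAt m a)

falseAt : ∀ {n} (m : Vec Bool n) → Fin (falses m) → Fin n
falseAt (false ∷ m) zero    = zero
falseAt (false ∷ m) (suc b) = suc (falseAt m b)
falseAt (true ∷ m)  b       = suc (falseAt m b)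

classify : ∀ {n} (m : Vec Bool n) → Fin n → Fin (trues m) ⊎ Fin (falses m)
classify (true ∷ m)  zero    = inj₁ zero
classify (false ∷ m) zero    = inj₂ zero
classify (true ∷ m)  (suc p) = Sum.map₁ suc (classify m p)
classify (false ∷ m) (suc p) = Sum.map₂ suc (classify m p)

classify-trueAt : ∀ {n} (m : Vec Bool n) a → classify m (trueAt m a) ≡ inj₁ a
classify-trueAt (true ∷ m)  zero    = refl
classify-trueAt (true ∷ m)  (suc a) = cong (Sum.map₁ suc) (classify-trueAt m a)
classify-trueAt (false ∷ m) a       = cong (Sum.map₂ suc) (classify-trueAt m a)

classify-falseAt : ∀ {n} (m : Vec Bool n) b → classify m (falseAt m b) ≡ inj₂ b
classify-falseAt (false ∷ m) zero    = refl
classify-falseAt (false ∷ m) (suc b) = cong (Sum.map₂ suc) (classify-falseAt m b)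
classify-falseAt (true ∷ m)  b       = cong (Sum.map₁ suc) (classify-falseAt m b)

data Side {n} (m : Vec Bool n) : Fin n → Set where
  inTrue  : ∀ a → Side m (trueAt m a)
  inFalse : ∀ b → Side m (falseAt m b)

side : ∀ {n} (m : Vec Bool n) p → Side m p
side (true ∷ m)  zero = inTrue zero
side (false ∷ m) zero = inFalse zero
side (true ∷ m)  (suc p) with side m p
... | inTrue a  = inTrue (suc a)
... | inFalse b = inFalse b
side (false ∷ m) (suc p) with side m p
... | inTrue a  = inTrue a
... | inFalse b = inFalse (suc b)

lookup-trueAt : ∀ {n} (m : Vec Bool n) a → lookup m (trueAt m a) ≡ true
lookup-trueAt (true ∷ m)  zero    = refl
lookup-trueAt (true ∷ m)  (suc a) = lookup-trueAt m a
lookup-trueAt (false ∷ m) a       = lookup-trueAt m a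

lookup-falseAt : ∀ {n} (m : Vec Bool n) b → lookup m (falseAt m b) ≡ false
lookup-falseAt (false ∷ m) zero    = refl
lookup-falseAt (false ∷ m) (suc b) = lookup-falseAt m b
lookup-falseAt (true ∷ m)  b       = lookup-falseAt m b

StrictlyMonotone : ∀ {k n} → (Fin k → Fin n) → Set
StrictlyMonotone e = ∀ {a b} → a < b → e a < e b

trueAt-mono : ∀ {n} (m : Vec Bool n) → StrictlyMonotone (trueAt m)
trueAt-mono (true ∷ m)  {zero}  {suc b} _           = s≤s z≤n
trueAt-mono (true ∷ m)  {suc a} {suc b} (s≤s a<b) = s≤s (trueAt-mono m a<b)
trueAt-mono (false ∷ m) a<b                         = s≤s (trueAt-mono m a<b)

falseAt-mono : ∀ {n} (m : Vec Bool n) → StrictlyMonotone (falseAt m)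
falseAt-mono (false ∷ m) {zero}  {suc b} _         = s≤s z≤n
falseAt-mono (false ∷ m) {suc a} {suc b} (s≤s a<b) = s≤s (falseAt-mono m a<b)
falseAt-mono (true ∷ m)  a<b                       = s≤s (falseAt-mono m a<b)

mono-reflects : ∀ {k n} {e : Fin k → Fin n} → StrictlyMonotone e →
  ∀ {a b} → e a < e b → a < b
mono-reflects mono {a} {b} ea<eb with FinP.<-cmp a b
... | tri< a<b _ _ = a<b
... | tri≈ _ refl _ = ⊥-elim (FinP.<-irrefl refl ea<eb)
... | tri> _ _ b<a = ⊥-elim (FinP.<-asym ea<eb (mono b<a))

every : ∀ {n} → (Fin n → Bool) → Bool
every {zero}  g = true
every {suc n} g = g zero ∧ every (g ∘ suc)

count : ∀ {n} → (Fin n → Bool) → ℕ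
count {zero}  g = 0
count {suc n} g = Bool.if g zero then suc (count (g ∘ suc)) else count (g ∘ suc)

all-allFin : ∀ {n} (g : Fin n → Bool) → all g (allFin n) ≡ every g
all-allFin g = go g id
  where
  go : ∀ {A : Set} {n} (g : A → Bool) (h : Fin n → A) → all g (tabulate h) ≡ every (g ∘ h)
  go {n = zero}  g h = refl
  go {n = suc n} g h = cong (g (h zero) ∧_) (go g (h ∘ suc))

countᵇ-count : ∀ {n} (g : Fin n → Bool) → countᵇ g ≡ count g
countᵇ-count g = go g id
  where
  go : ∀ {A : Set} {n} (g : A → Bool) (h : Fin n → A) →
    length (filter (λ x → g x Bool.≟ true) (tabulate h)) ≡ count (g ∘ h)
  go {n = zero}  g h = refl
  go {n = suc n} g h with g (h zero)
  ... | true  = cong suc (go g (h ∘ suc))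
  ... | false = go g (h ∘ suc)

every-intro : ∀ {n} {g : Fin n → Bool} → (∀ x → T (g x)) → T (every g)
every-intro {zero}  h = tt
every-intro {suc n} h = ∧-intro (h zero) (every-intro (h ∘ suc))

every-elim : ∀ {n} {g : Fin n → Bool} → T (every g) → ∀ x → T (g x)
every-elim {suc n} {g} t zero    = ∧-fst t
every-elim {suc n} {g} t (suc x) = every-elim (∧-snd {g zero} t) x

every-cong : ∀ {n} {g h : Fin n → Bool} → (∀ x → g x ≡ h x) → every g ≡ every h
every-cong {zero}  e = refl
every-cong {suc n} e = cong₂ _∧_ (e zero) (every-cong (e ∘ suc))

count-cong : ∀ {n} {g h : Fin n → Bool} → (∀ x → g x ≡ h x) → count g ≡ count h
count-cong {zero}  e = refl
count-cong {suc n} {g} {h} e rewrite e zero with h zero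
... | true  = cong suc (count-cong (e ∘ suc))
... | false = count-cong (e ∘ suc)

count-none : ∀ {n} {g : Fin n → Bool} → (∀ x → g x ≡ false) → count g ≡ 0
count-none {zero}  h = refl
count-none {suc n} h rewrite h zero = count-none (h ∘ suc)

count-zero : ∀ {n} {g : Fin n → Bool} → count g ≡ 0 → ∀ x → g x ≡ false
count-zero {suc n} {g} c x with g zero in g0
count-zero {suc n} {g} () x | true
count-zero {suc n} {g} c zero    | false = g0
count-zero {suc n} {g} c (suc x) | false = count-zero c x

every-split : ∀ {n} (m : Vec Bool n) (g : Fin n → Bool) →
  every g ≡ every (g ∘ trueAt m) ∧ every (g ∘ falseAt m)
every-split []          g = refl
every-split (true ∷ m)  g = trans (cong (g zero ∧_) (every-split m (g ∘ suc)))
                                  (sym (BoolP.∧-assoc (g zero) _ _))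
every-split (false ∷ m) g = trans (cong (g zero ∧_) (every-split m (g ∘ suc)))
                                  (∧-swap (g zero) (every (g ∘ suc ∘ trueAt m)) _)
  where
  ∧-swap : ∀ x y z → x ∧ (y ∧ z) ≡ y ∧ (x ∧ z)
  ∧-swap true  y z = refl
  ∧-swap false y z = sym (BoolP.∧-zeroʳ y)

count-split : ∀ {n} (m : Vec Bool n) (g : Fin n → Bool) →
  count g ≡ count (g ∘ trueAt m) + count (g ∘ falseAt m)
count-split []          g = refl
count-split (true ∷ m)  g with g zero
... | true  = cong suc (count-split m (g ∘ suc))
... | false = count-split m (g ∘ suc)
count-split (false ∷ m) g with g zero
... | true  = trans (cong suc (count-split m (g ∘ suc))) (sym (ℕP.+-suc _ _))
... | false = count-split m (g ∘ suc)

allFin-elim : ∀ {n} {g : Fin n → Bool} → T (all g (allFin n)) → ∀ x → T (g x)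
allFin-elim {g = g} t = every-elim (subst T (all-allFin g) t)

allFin-intro : ∀ {n} {g : Fin n → Bool} → (∀ x → T (g x)) → T (all g (allFin n))
allFin-intro {g = g} h = subst T (sym (all-allFin g)) (every-intro h)

Cell : ∀ {n} → (Fin n → Bool) → Fin n → Fin n → Set
Cell σ p q = T (σ p) × T (not (σ q)) × p < q

record Valid {n} (σ : Fin n → Bool) (φ : Fin n → Fin n → Arrow) : Set where
  field
    arrow⇒cell : ∀ {p q} → φ p q ≢ empty → Cell σ p q
    leftRule   : ∀ {p q q'} → φ p q ≡ left → Cell σ p q' → q < q' → φ p q' ≡ empty
    upRule     : ∀ {p q p'} → φ p q ≡ up → Cell σ p' q → p' < p → φ p' q ≡ empty
open Valid

isCell⇒ : ∀ {n} (s : Shape n) {p q} → T (isCell s p q) → Cell (lookup s) p q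
isCell⇒ s {p} {q} t with Equivalence.to BoolP.T-∧ t
... | r , t' with Equivalence.to BoolP.T-∧ t'
... | c , lt = r , c , ℕP.<ᵇ⇒< (toℕ p) (toℕ q) lt

isCell⇐ : ∀ {n} (s : Shape n) {p q} → Cell (lookup s) p q → T (isCell s p q)
isCell⇐ s (r , c , lt) =
  ∧-intro r (∧-intro c (ℕP.<⇒<ᵇ lt))

cellClause⇒ : ∀ {c} w → T (not c ⇒ᵇ isEmpty w) → w ≢ empty → T c
cellClause⇒ {true}  w     _  _  = tt
cellClause⇒ {false} empty _  ne = ⊥-elim (ne refl)

cellClause⇐ : ∀ c w → (w ≢ empty → T c) → T (not c ⇒ᵇ isEmpty w)
cellClause⇐ true  w     h = tt
cellClause⇐ false empty h = tt
cellClause⇐ false left  h = h (λ ())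
cellClause⇐ false up    h = h (λ ())

ruleClause⇒ : ∀ {b c u} w → T ((b ∧ c ∧ u) ⇒ᵇ isEmpty w) → T b → T c → T u → w ≡ empty
ruleClause⇒ {true} {true} {true} empty _ _ _ _ = refl

ruleClause⇐ : ∀ b c u {w} → (T b → T c → T u → w ≡ empty) → T ((b ∧ c ∧ u) ⇒ᵇ isEmpty w)
ruleClause⇐ true  true  true  h rewrite h tt tt tt = tt
ruleClause⇐ true  true  false h = tt
ruleClause⇐ true  false u     h = tt
ruleClause⇐ false c     u     h = tt

isLeft⇐ : ∀ {a} → a ≡ left → T (isLeft a)
isLeft⇐ refl = tt

isUp⇐ : ∀ {a} → a ≡ up → T (isUp a)
isUp⇐ refl = tt

isLeft⇒ : ∀ {a} → T (isLeft a) → a ≡ left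
isLeft⇒ {left} _ = refl

isUp⇒ : ∀ {a} → T (isUp a) → a ≡ up
isUp⇒ {up} _ = refl

valid⇒ : ∀ {n} (s : Shape n) (F : Filling n) → T (isAlternative s F) → Valid (lookup s) (entry F)
valid⇒ s F t with Equivalence.to BoolP.T-∧ t
... | cells , t' with Equivalence.to BoolP.T-∧ t'
... | lefts , ups = record
  { arrow⇒cell = λ {p} {q} ne → isCell⇒ s (cellClause⇒ _ (allFin-elim (allFin-elim cells p) q) ne)
  ; leftRule   = λ {p} {q} {q'} e c lt → ruleClause⇒ _ (allFin-elim (allFin-elim (allFin-elim lefts p) q) q')
                                          (isLeft⇐ e) (isCell⇐ s c) (ℕP.<⇒<ᵇ lt)
  ; upRule     = λ {p} {q} {p'} e c lt → ruleClause⇒ _ (allFin-elim (allFin-elim (allFin-elim ups p) q) p')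
                                          (isUp⇐ e) (isCell⇐ s c) (ℕP.<⇒<ᵇ lt)
  }

valid⇐ : ∀ {n} (s : Shape n) (F : Filling n) → Valid (lookup s) (entry F) → T (isAlternative s F)
valid⇐ s F v = ∧-intro cells (∧-intro lefts ups)
  where
  cells : T (onlyCellsFilled s F)
  cells = allFin-intro λ p → allFin-intro λ q →
    cellClause⇐ (isCell s p q) (entry F p q) (λ ne → isCell⇐ s (arrow⇒cell v ne))
  lefts : T (leftCondition s F)
  lefts = allFin-intro λ p → allFin-intro λ q → allFin-intro λ q' →
    ruleClause⇐ (isLeft (entry F p q)) (isCell s p q') (q <ᵇ q')
      (λ l c lt → leftRule v (isLeft⇒ l) (isCell⇒ s c) (ℕP.<ᵇ⇒< _ _ lt))
  ups : T (upCondition s F)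
  ups = allFin-intro λ p → allFin-intro λ q → allFin-intro λ p' →
    ruleClause⇐ (isUp (entry F p q)) (isCell s p' q) (p' <ᵇ p)
      (λ u c lt → upRule v (isUp⇒ u) (isCell⇒ s c) (ℕP.<ᵇ⇒< _ _ lt))

Cell-cong : ∀ {n} {σ σ' : Fin n → Bool} → (∀ p → σ p ≡ σ' p) → ∀ {p q} → Cell σ p q → Cell σ' p q
Cell-cong e {p} {q} (r , c , lt) = subst T (e p) r , subst (T ∘ not) (e q) c , lt

Valid-cong : ∀ {n} {σ σ' : Fin n → Bool} {φ φ' : Fin n → Fin n → Arrow} →
  (∀ p → σ p ≡ σ' p) → (∀ p q → φ p q ≡ φ' p q) → Valid σ φ → Valid σ' φ'
Valid-cong {φ = φ} {φ'} eσ eφ v = record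
  { arrow⇒cell = λ {p} {q} ne → Cell-cong eσ (arrow⇒cell v (ne ∘ trans (sym (eφ p q))))
  ; leftRule   = λ {p} {q} {q'} l c lt → trans (sym (eφ p q'))
                   (leftRule v (trans (eφ p q) l) (Cell-cong (sym ∘ eσ) c) lt)
  ; upRule     = λ {p} {q} {p'} u c lt → trans (sym (eφ p' q))
                   (upRule v (trans (eφ p q) u) (Cell-cong (sym ∘ eσ) c) lt)
  }

cell-along : ∀ {k n} {σ : Fin n → Bool} {e : Fin k → Fin n} → StrictlyMonotone e →
  ∀ {a b} → Cell (σ ∘ e) a b → Cell σ (e a) (e b)
cell-along mono (r , c , lt) = r , c , mono lt

cell-back : ∀ {k n} {σ : Fin n → Bool} {e : Fin k → Fin n} → StrictlyMonotone e →
  ∀ {a b} → Cell σ (e a) (e b) → Cell (σ ∘ e) a b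
cell-back mono (r , c , lt) = r , c , mono-reflects mono lt

-- Restricting a valid filling to the steps enumerated by an order
-- embedding e gives a valid filling: the tableau conditions only refer
-- to the relative order of steps.
reindex : ∀ {k n} {σ : Fin n → Bool} {φ : Fin n → Fin n → Arrow} (e : Fin k → Fin n) →
  StrictlyMonotone e → Valid σ φ → Valid (σ ∘ e) (λ a b → φ (e a) (e b))
reindex {σ = σ} e mono v = record
  { arrow⇒cell = λ ne → cell-back {σ = σ} mono (arrow⇒cell v ne)
  ; leftRule   = λ l c b<b' → leftRule v l (cell-along {σ = σ} mono c) (mono b<b')
  ; upRule     = λ u c a'<a → upRule v u (cell-along {σ = σ} mono c) (mono a'<a)
  }

vec-ext : ∀ {A : Set} {k} {u w : Vec A k} → (∀ i → lookup u i ≡ lookup w i) → u ≡ w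
vec-ext {u = u} {w} h =
  trans (sym (VecP.tabulate∘lookup u)) (trans (VecP.tabulate-cong h) (VecP.tabulate∘lookup w))

rowOf : ∀ {n} → AltTableau n → Fin n → Bool
rowOf t = lookup (shape t)

arrowOf : ∀ {n} → AltTableau n → Fin n → Fin n → Arrow
arrowOf t = entry (filling t)

validOf : ∀ {n} (t : AltTableau n) → Valid (rowOf t) (arrowOf t)
validOf t = valid⇒ (shape t) (filling t) (valid t)

tabulate² : ∀ {n} → (Fin n → Fin n → Arrow) → Filling n
tabulate² φ = Vec.tabulate (λ p → Vec.tabulate (φ p))

entry-tabulate² : ∀ {n} (φ : Fin n → Fin n → Arrow) p q → entry (tabulate² φ) p q ≡ φ p q
entry-tabulate² φ p q =
  trans (cong (λ r → lookup r q) (VecP.lookup∘tabulate _ p)) (VecP.lookup∘tabulate (φ p) q)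

buildTableau : ∀ {n} (σ : Fin n → Bool) (φ : Fin n → Fin n → Arrow) → Valid σ φ → AltTableau n
buildTableau σ φ v = altTableau (Vec.tabulate σ) (tabulate² φ)
  (valid⇐ (Vec.tabulate σ) (tabulate² φ)
    (Valid-cong (sym ∘ VecP.lookup∘tabulate σ) (λ p q → sym (entry-tabulate² φ p q)) v))

rowOf-build : ∀ {n} σ φ (v : Valid {n} σ φ) p → rowOf (buildTableau σ φ v) p ≡ σ p
rowOf-build σ φ v = VecP.lookup∘tabulate σ

arrowOf-build : ∀ {n} σ φ (v : Valid {n} σ φ) p q → arrowOf (buildTableau σ φ v) p q ≡ φ p q
arrowOf-build σ φ v = entry-tabulate² φ

-- Tableaux are equal as soon as they agree pointwise (validity is a Boolean proof).
tableau-ext : ∀ {n} {t t' : AltTableau n} →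
  (∀ p → rowOf t p ≡ rowOf t' p) → (∀ p q → arrowOf t p q ≡ arrowOf t' p q) → t ≡ t'
tableau-ext {t = altTableau s F v} {altTableau s' F' v'} eσ eφ = go (vec-ext eσ) (vec-ext λ p → vec-ext (eφ p))
  where
  go : s ≡ s' → F ≡ F' → altTableau s F v ≡ altTableau s' F' v'
  go refl refl = cong (altTableau s F) (BoolP.T-irrelevant v v')

isFreeRow : ∀ {n} → (Fin n → Bool) → (Fin n → Fin n → Arrow) → Fin n → Bool
isFreeRow σ φ p = σ p ∧ every (λ q → not (isLeft (φ p q)))

isFreeCol : ∀ {n} → (Fin n → Bool) → (Fin n → Fin n → Arrow) → Fin n → Bool
isFreeCol σ φ q = not (σ q) ∧ every (λ p → not (isUp (φ p q)))

freeRowᵇ freeColᵇ : ∀ {n} → AltTableau n → Fin n → Bool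
freeRowᵇ t = isFreeRow (rowOf t) (arrowOf t)
freeColᵇ t = isFreeCol (rowOf t) (arrowOf t)

freeRows-count : ∀ {n} (t : AltTableau n) → freeRows t ≡ count (freeRowᵇ t)
freeRows-count {n} t = trans (countᵇ-count (λ p → rowOf t p ∧ all (noLeft p) (allFin n)))
                              (count-cong λ p → cong (rowOf t p ∧_) (all-allFin (noLeft p)))
  where
  noLeft : Fin n → Fin n → Bool
  noLeft p q = not (isLeft (arrowOf t p q))

freeCols-count : ∀ {n} (t : AltTableau n) → freeCols t ≡ count (freeColᵇ t)
freeCols-count {n} t = trans (countᵇ-count (λ q → not (rowOf t q) ∧ all (noUp q) (allFin n)))
                              (count-cong λ q → cong (not (rowOf t q) ∧_) (all-allFin (noUp q)))
  where
  noUp : Fin n → Fin n → Bool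
  noUp q p = not (isUp (arrowOf t p q))

isFreeRow-cong : ∀ {n} {σ σ' : Fin n → Bool} {φ φ' : Fin n → Fin n → Arrow} →
  (∀ p → σ p ≡ σ' p) → (∀ p q → φ p q ≡ φ' p q) → ∀ p → isFreeRow σ φ p ≡ isFreeRow σ' φ' p
isFreeRow-cong eσ eφ p = cong₂ _∧_ (eσ p) (every-cong λ q → cong (not ∘ isLeft) (eφ p q))

isFreeCol-cong : ∀ {n} {σ σ' : Fin n → Bool} {φ φ' : Fin n → Fin n → Arrow} →
  (∀ p → σ p ≡ σ' p) → (∀ p q → φ p q ≡ φ' p q) → ∀ q → isFreeCol σ φ q ≡ isFreeCol σ' φ' q
isFreeCol-cong eσ eφ q = cong₂ _∧_ (cong not (eσ q)) (every-cong λ p → cong (not ∘ isUp) (eφ p q))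

notLeft⇒ : ∀ {a} → T (not (isLeft a)) → a ≢ left
notLeft⇒ {empty} _ ()
notLeft⇒ {up}    _ ()

notLeft⇐ : ∀ a → a ≢ left → T (not (isLeft a))
notLeft⇐ empty _  = tt
notLeft⇐ left  ne = ne refl
notLeft⇐ up    _  = tt

notUp⇒ : ∀ {a} → T (not (isUp a)) → a ≢ up
notUp⇒ {empty} _ ()
notUp⇒ {left}  _ ()

notUp⇐ : ∀ a → a ≢ up → T (not (isUp a))
notUp⇐ empty _  = tt
notUp⇐ left  _  = tt
notUp⇐ up    ne = ne refl

freeRow⇒ : ∀ {n} {σ : Fin n → Bool} {φ p} → T (isFreeRow σ φ p) → ∀ q → φ p q ≢ left
freeRow⇒ t q = notLeft⇒ (every-elim (proj₂ (Equivalence.to BoolP.T-∧ t)) q)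

freeRow⇐ : ∀ {n} {σ : Fin n → Bool} {φ p} → T (σ p) → (∀ q → φ p q ≢ left) → T (isFreeRow σ φ p)
freeRow⇐ {φ = φ} {p} r h = ∧-intro r (every-intro λ q → notLeft⇐ (φ p q) (h q))

freeCol⇒ : ∀ {n} {σ : Fin n → Bool} {φ q} → T (isFreeCol σ φ q) → ∀ p → φ p q ≢ up
freeCol⇒ t p = notUp⇒ (every-elim (proj₂ (Equivalence.to BoolP.T-∧ t)) p)

freeCol⇐ : ∀ {n} {σ : Fin n → Bool} {φ q} → T (not (σ q)) → (∀ p → φ p q ≢ up) → T (isFreeCol σ φ q)
freeCol⇐ {φ = φ} {q} c h = ∧-intro c (every-intro λ p → notUp⇐ (φ p q) (h p))

Separated : ∀ {n} → Vec Bool n → (Fin n → Fin n → Arrow) → Set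
Separated m φ = ∀ {p q} → φ p q ≢ empty → lookup m p ≡ lookup m q

cross-empty : ∀ {n} (m : Vec Bool n) {φ : Fin n → Fin n → Arrow} → Separated m φ →
  ∀ {p q} → lookup m p ≢ lookup m q → φ p q ≡ empty
cross-empty m {φ} sep {p} {q} ne with φ p q in e
... | empty = refl
... | left  = ⊥-elim (ne (sep (left-nonempty e)))
... | up    = ⊥-elim (ne (sep (up-nonempty e)))

classes-differ : ∀ {n} (m : Vec Bool n) a b → lookup m (trueAt m a) ≢ lookup m (falseAt m b)
classes-differ m a b e = true≢false (trans (sym (lookup-trueAt m a)) (trans e (lookup-falseAt m b)))

true-false-empty : ∀ {n} (m : Vec Bool n) {φ : Fin n → Fin n → Arrow} → Separated m φ →
  ∀ a b → φ (trueAt m a) (falseAt m b) ≡ empty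
true-false-empty m {φ} sep a b = cross-empty m {φ} sep (classes-differ m a b)

false-true-empty : ∀ {n} (m : Vec Bool n) {φ : Fin n → Fin n → Arrow} → Separated m φ →
  ∀ b a → φ (falseAt m b) (trueAt m a) ≡ empty
false-true-empty m {φ} sep b a = cross-empty m {φ} sep (classes-differ m a b ∘ sym)

Valid-glue : ∀ {n} (m : Vec Bool n) {σ : Fin n → Bool} {φ : Fin n → Fin n → Arrow} →
  Separated m φ →
  Valid (σ ∘ trueAt m) (λ a b → φ (trueAt m a) (trueAt m b)) →
  Valid (σ ∘ falseAt m) (λ a b → φ (falseAt m a) (falseAt m b)) →
  Valid σ φ
Valid-glue m {σ} {φ} sep vT vF = record { arrow⇒cell = cell ; leftRule = leftR ; upRule = upR }
  where
  TF : ∀ a b → φ (trueAt m a) (falseAt m b) ≡ empty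
  TF = true-false-empty m {φ} sep
  FT : ∀ a b → φ (falseAt m b) (trueAt m a) ≡ empty
  FT a b = false-true-empty m {φ} sep b a
  cell : ∀ {p q} → φ p q ≢ empty → Cell σ p q
  cell {p} {q} ne with side m p | side m q
  ... | inTrue a  | inTrue b  = cell-along {σ = σ} (trueAt-mono m) (arrow⇒cell vT ne)
  ... | inFalse a | inFalse b = cell-along {σ = σ} (falseAt-mono m) (arrow⇒cell vF ne)
  ... | inTrue a  | inFalse b = ⊥-elim (ne (TF a b))
  ... | inFalse a | inTrue b  = ⊥-elim (ne (FT b a))
  leftR : ∀ {p q q'} → φ p q ≡ left → Cell σ p q' → q < q' → φ p q' ≡ empty
  leftR {p} {q} {q'} l c lt with side m p | side m q | side m q'
  ... | inTrue a  | inTrue b  | inTrue b'  =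
    leftRule vT l (cell-back {σ = σ} (trueAt-mono m) c) (mono-reflects (trueAt-mono m) lt)
  ... | inFalse a | inFalse b | inFalse b' =
    leftRule vF l (cell-back {σ = σ} (falseAt-mono m) c) (mono-reflects (falseAt-mono m) lt)
  ... | inTrue a  | _         | inFalse b' = TF a b'
  ... | inFalse a | _         | inTrue b'  = FT b' a
  ... | inTrue a  | inFalse b | inTrue _   with () ← trans (sym l) (TF a b)
  ... | inFalse a | inTrue b  | inFalse _  with () ← trans (sym l) (FT b a)
  upR : ∀ {p q p'} → φ p q ≡ up → Cell σ p' q → p' < p → φ p' q ≡ empty
  upR {p} {q} {p'} u c lt with side m p | side m q | side m p'
  ... | inTrue a  | inTrue b  | inTrue a'  =
    upRule vT u (cell-back {σ = σ} (trueAt-mono m) c) (mono-reflects (trueAt-mono m) lt)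
  ... | inFalse a | inFalse b | inFalse a' =
    upRule vF u (cell-back {σ = σ} (falseAt-mono m) c) (mono-reflects (falseAt-mono m) lt)
  ... | _         | inTrue b  | inFalse a' = FT b a'
  ... | _         | inFalse b | inTrue a'  = TF a' b
  ... | inTrue a  | inFalse b | inFalse _  with () ← trans (sym u) (TF a b)
  ... | inFalse a | inTrue b  | inTrue _   with () ← trans (sym u) (FT b a)

restrict : ∀ {k n} (e : Fin k → Fin n) → StrictlyMonotone e → AltTableau n → AltTableau k
restrict e mono t = buildTableau (rowOf t ∘ e) (λ a b → arrowOf t (e a) (e b)) (reindex e mono (validOf t))

restrictTrue : ∀ {n} (m : Vec Bool n) → AltTableau n → AltTableau (trues m)
restrictTrue m = restrict (trueAt m) (trueAt-mono m)

restrictFalse : ∀ {n} (m : Vec Bool n) → AltTableau n → AltTableau (falses m)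
restrictFalse m = restrict (falseAt m) (falseAt-mono m)

rowOf-restrict : ∀ {k n} (e : Fin k → Fin n) (mono : StrictlyMonotone e) t a →
  rowOf (restrict e mono t) a ≡ rowOf t (e a)
rowOf-restrict e mono t = rowOf-build (rowOf t ∘ e) (λ a b → arrowOf t (e a) (e b)) (reindex e mono (validOf t))

arrowOf-restrict : ∀ {k n} (e : Fin k → Fin n) (mono : StrictlyMonotone e) t a b →
  arrowOf (restrict e mono t) a b ≡ arrowOf t (e a) (e b)
arrowOf-restrict e mono t = arrowOf-build (rowOf t ∘ e) (λ a b → arrowOf t (e a) (e b)) (reindex e mono (validOf t))

-- Two enumerations e, e' of complementary sets of steps.
Complementary : ∀ {k k' n} → (Fin k → Fin n) → (Fin k' → Fin n) → Set
Complementary e e' = ∀ g → every g ≡ every (g ∘ e) ∧ every (g ∘ e')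

true-false-complementary : ∀ {n} (m : Vec Bool n) → Complementary (trueAt m) (falseAt m)
true-false-complementary = every-split

false-true-complementary : ∀ {n} (m : Vec Bool n) → Complementary (falseAt m) (trueAt m)
false-true-complementary m g = trans (every-split m g) (BoolP.∧-comm (every (g ∘ trueAt m)) _)

freeRow-restrict : ∀ {k k' n} (t : AltTableau n) {e : Fin k → Fin n} {e' : Fin k' → Fin n}
  (mono : StrictlyMonotone e) → Complementary e e' →
  (∀ a b → arrowOf t (e a) (e' b) ≡ empty) →
  ∀ a → freeRowᵇ t (e a) ≡ freeRowᵇ (restrict e mono t) a
freeRow-restrict t {e} {e'} mono compl cross a = begin
  freeRowᵇ t (e a)
    ≡⟨ cong (rowOf t (e a) ∧_) (compl _) ⟩
  rowOf t (e a) ∧ (every (λ b → not (isLeft (arrowOf t (e a) (e b)))) ∧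
                   every (λ b → not (isLeft (arrowOf t (e a) (e' b)))))
    ≡⟨ cong (λ x → rowOf t (e a) ∧ (_ ∧ x)) outside ⟩
  rowOf t (e a) ∧ (every (λ b → not (isLeft (arrowOf t (e a) (e b)))) ∧ true)
    ≡⟨ cong (rowOf t (e a) ∧_) (BoolP.∧-identityʳ _) ⟩
  isFreeRow (rowOf t ∘ e) (λ a b → arrowOf t (e a) (e b)) a
    ≡⟨ isFreeRow-cong (sym ∘ rowOf-restrict e mono t) (λ a b → sym (arrowOf-restrict e mono t a b)) a ⟩
  freeRowᵇ (restrict e mono t) a ∎
  where
  open ≡-Reasoning
  outside : every (λ b → not (isLeft (arrowOf t (e a) (e' b)))) ≡ true
  outside = Equivalence.to BoolP.T-≡ (every-intro λ b → subst (T ∘ not ∘ isLeft) (sym (cross a b)) tt)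

freeCol-restrict : ∀ {k k' n} (t : AltTableau n) {e : Fin k → Fin n} {e' : Fin k' → Fin n}
  (mono : StrictlyMonotone e) → Complementary e e' →
  (∀ a b → arrowOf t (e' b) (e a) ≡ empty) →
  ∀ a → freeColᵇ t (e a) ≡ freeColᵇ (restrict e mono t) a
freeCol-restrict t {e} {e'} mono compl cross a = begin
  freeColᵇ t (e a)
    ≡⟨ cong (not (rowOf t (e a)) ∧_) (compl _) ⟩
  not (rowOf t (e a)) ∧ (every (λ b → not (isUp (arrowOf t (e b) (e a)))) ∧
                         every (λ b → not (isUp (arrowOf t (e' b) (e a)))))
    ≡⟨ cong (λ x → not (rowOf t (e a)) ∧ (_ ∧ x)) outside ⟩
  not (rowOf t (e a)) ∧ (every (λ b → not (isUp (arrowOf t (e b) (e a)))) ∧ true)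
    ≡⟨ cong (not (rowOf t (e a)) ∧_) (BoolP.∧-identityʳ _) ⟩
  isFreeCol (rowOf t ∘ e) (λ a b → arrowOf t (e a) (e b)) a
    ≡⟨ isFreeCol-cong (sym ∘ rowOf-restrict e mono t) (λ a b → sym (arrowOf-restrict e mono t a b)) a ⟩
  freeColᵇ (restrict e mono t) a ∎
  where
  open ≡-Reasoning
  outside : every (λ b → not (isUp (arrowOf t (e' b) (e a)))) ≡ true
  outside = Equivalence.to BoolP.T-≡ (every-intro λ b → subst (T ∘ not ∘ isUp) (sym (cross a b)) tt)

module _ {n} (m : Vec Bool n) (t : AltTableau n) (sep : Separated m (arrowOf t)) where

  freeRow-true : ∀ a → freeRowᵇ t (trueAt m a) ≡ freeRowᵇ (restrictTrue m t) a
  freeRow-true = freeRow-restrict t (trueAt-mono m) (true-false-complementary m) (true-false-empty m sep)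

  freeRow-false : ∀ b → freeRowᵇ t (falseAt m b) ≡ freeRowᵇ (restrictFalse m t) b
  freeRow-false = freeRow-restrict t (falseAt-mono m) (false-true-complementary m) (false-true-empty m sep)

  freeCol-true : ∀ a → freeColᵇ t (trueAt m a) ≡ freeColᵇ (restrictTrue m t) a
  freeCol-true = freeCol-restrict t (trueAt-mono m) (true-false-complementary m)
                   (λ a b → false-true-empty m sep b a)

  freeCol-false : ∀ b → freeColᵇ t (falseAt m b) ≡ freeColᵇ (restrictFalse m t) b
  freeCol-false = freeCol-restrict t (falseAt-mono m) (false-true-complementary m)
                    (λ b a → true-false-empty m sep a b)

  freeRows-split : freeRows t ≡ freeRows (restrictTrue m t) + freeRows (restrictFalse m t)
  freeRows-split = begin
    freeRows t                                                      ≡⟨ freeRows-count t ⟩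
    count (freeRowᵇ t)                                              ≡⟨ count-split m (freeRowᵇ t) ⟩
    count (freeRowᵇ t ∘ trueAt m) + count (freeRowᵇ t ∘ falseAt m)  ≡⟨ cong₂ _+_ (count-cong freeRow-true)
                                                                                  (count-cong freeRow-false) ⟩
    count (freeRowᵇ (restrictTrue m t)) + count (freeRowᵇ (restrictFalse m t))
      ≡⟨ sym (cong₂ _+_ (freeRows-count (restrictTrue m t)) (freeRows-count (restrictFalse m t))) ⟩
    freeRows (restrictTrue m t) + freeRows (restrictFalse m t)      ∎
    where open ≡-Reasoning

  freeCols-split : freeCols t ≡ freeCols (restrictTrue m t) + freeCols (restrictFalse m t)
  freeCols-split = begin
    freeCols t                                                      ≡⟨ freeCols-count t ⟩
    count (freeColᵇ t)                                              ≡⟨ count-split m (freeColᵇ t) ⟩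
    count (freeColᵇ t ∘ trueAt m) + count (freeColᵇ t ∘ falseAt m)  ≡⟨ cong₂ _+_ (count-cong freeCol-true)
                                                                                  (count-cong freeCol-false) ⟩
    count (freeColᵇ (restrictTrue m t)) + count (freeColᵇ (restrictFalse m t))
      ≡⟨ sym (cong₂ _+_ (freeCols-count (restrictTrue m t)) (freeCols-count (restrictFalse m t))) ⟩
    freeCols (restrictTrue m t) + freeCols (restrictFalse m t)      ∎
    where open ≡-Reasoning

mergeRow : ∀ {n} (m : Vec Bool n) → (Fin (trues m) → Bool) → (Fin (falses m) → Bool) → Fin n → Bool
mergeRow m σP σQ p = Sum.[ σP , σQ ] (classify m p)

mergeArrow : ∀ {n} (m : Vec Bool n) → (Fin (trues m) → Fin (trues m) → Arrow) →
  (Fin (falses m) → Fin (falses m) → Arrow) → Fin n → Fin n → Arrow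
mergeArrow m φP φQ p q = between (classify m p) (classify m q)
  where
  between : Fin (trues m) ⊎ Fin (falses m) → Fin (trues m) ⊎ Fin (falses m) → Arrow
  between (inj₁ a) (inj₁ b) = φP a b
  between (inj₂ a) (inj₂ b) = φQ a b
  between _        _        = empty

module MergeComputation {n} (m : Vec Bool n) {σP : Fin (trues m) → Bool} {σQ : Fin (falses m) → Bool}
         {φP : Fin (trues m) → Fin (trues m) → Arrow} {φQ : Fin (falses m) → Fin (falses m) → Arrow} where

  mergeRow-true : ∀ a → mergeRow m σP σQ (trueAt m a) ≡ σP a
  mergeRow-true a rewrite classify-trueAt m a = refl

  mergeRow-false : ∀ b → mergeRow m σP σQ (falseAt m b) ≡ σQ b
  mergeRow-false b rewrite classify-falseAt m b = refl

  mergeArrow-true : ∀ a a' → mergeArrow m φP φQ (trueAt m a) (trueAt m a') ≡ φP a a'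
  mergeArrow-true a a' rewrite classify-trueAt m a | classify-trueAt m a' = refl

  mergeArrow-false : ∀ b b' → mergeArrow m φP φQ (falseAt m b) (falseAt m b') ≡ φQ b b'
  mergeArrow-false b b' rewrite classify-falseAt m b | classify-falseAt m b' = refl

  mergeArrow-separated : Separated m (mergeArrow m φP φQ)
  mergeArrow-separated {p} {q} ne with side m p | side m q
  ... | inTrue a  | inTrue b  = trans (lookup-trueAt m a) (sym (lookup-trueAt m b))
  ... | inFalse a | inFalse b = trans (lookup-falseAt m a) (sym (lookup-falseAt m b))
  ... | inTrue a  | inFalse b rewrite classify-trueAt m a | classify-falseAt m b = ⊥-elim (ne refl)
  ... | inFalse a | inTrue b  rewrite classify-falseAt m a | classify-trueAt m b = ⊥-elim (ne refl)

-- The merge is valid: it is separated and its restrictions are P and Q.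
mergeValid : ∀ {n} (m : Vec Bool n) (P : AltTableau (trues m)) (Q : AltTableau (falses m)) →
  Valid (mergeRow m (rowOf P) (rowOf Q)) (mergeArrow m (arrowOf P) (arrowOf Q))
mergeValid m P Q =
  Valid-glue m mergeArrow-separated
    (Valid-cong (sym ∘ mergeRow-true) (λ a a' → sym (mergeArrow-true a a')) (validOf P))
    (Valid-cong (sym ∘ mergeRow-false) (λ b b' → sym (mergeArrow-false b b')) (validOf Q))
  where open MergeComputation m {rowOf P} {rowOf Q} {arrowOf P} {arrowOf Q}

merge : ∀ {n} (m : Vec Bool n) → AltTableau (trues m) → AltTableau (falses m) → AltTableau n
merge m P Q = buildTableau (mergeRow m (rowOf P) (rowOf Q)) (mergeArrow m (arrowOf P) (arrowOf Q)) (mergeValid m P Q)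

module _ {n} (m : Vec Bool n) (P : AltTableau (trues m)) (Q : AltTableau (falses m)) where
  open MergeComputation m {rowOf P} {rowOf Q} {arrowOf P} {arrowOf Q}

  rowOf-merge : ∀ p → rowOf (merge m P Q) p ≡ mergeRow m (rowOf P) (rowOf Q) p
  rowOf-merge = rowOf-build (mergeRow m (rowOf P) (rowOf Q)) (mergeArrow m (arrowOf P) (arrowOf Q)) (mergeValid m P Q)

  arrowOf-merge : ∀ p q → arrowOf (merge m P Q) p q ≡ mergeArrow m (arrowOf P) (arrowOf Q) p q
  arrowOf-merge = arrowOf-build (mergeRow m (rowOf P) (rowOf Q)) (mergeArrow m (arrowOf P) (arrowOf Q)) (mergeValid m P Q)

  merge-separated : Separated m (arrowOf (merge m P Q))
  merge-separated {p} {q} ne = mergeArrow-separated (ne ∘ trans (arrowOf-merge p q))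

  restrictTrue-merge : restrictTrue m (merge m P Q) ≡ P
  restrictTrue-merge = tableau-ext
    (λ a → trans (rowOf-restrict (trueAt m) (trueAt-mono m) (merge m P Q) a)
                 (trans (rowOf-merge (trueAt m a)) (mergeRow-true a)))
    (λ a a' → trans (arrowOf-restrict (trueAt m) (trueAt-mono m) (merge m P Q) a a')
                    (trans (arrowOf-merge (trueAt m a) (trueAt m a')) (mergeArrow-true a a')))

  restrictFalse-merge : restrictFalse m (merge m P Q) ≡ Q
  restrictFalse-merge = tableau-ext
    (λ b → trans (rowOf-restrict (falseAt m) (falseAt-mono m) (merge m P Q) b)
                 (trans (rowOf-merge (falseAt m b)) (mergeRow-false b)))
    (λ b b' → trans (arrowOf-restrict (falseAt m) (falseAt-mono m) (merge m P Q) b b')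
                    (trans (arrowOf-merge (falseAt m b) (falseAt m b')) (mergeArrow-false b b')))

merge-restrict : ∀ {n} (m : Vec Bool n) (t : AltTableau n) → Separated m (arrowOf t) →
  merge m (restrictTrue m t) (restrictFalse m t) ≡ t
merge-restrict m t sep = tableau-ext rows arrows
  where
  P : AltTableau (trues m)
  P = restrictTrue m t
  Q : AltTableau (falses m)
  Q = restrictFalse m t
  open MergeComputation m {rowOf P} {rowOf Q} {arrowOf P} {arrowOf Q}
  rows : ∀ p → rowOf (merge m P Q) p ≡ rowOf t p
  rows p with side m p
  ... | inTrue a  = trans (rowOf-merge m P Q _) (trans (mergeRow-true a) (rowOf-restrict (trueAt m) (trueAt-mono m) t a))
  ... | inFalse b = trans (rowOf-merge m P Q _) (trans (mergeRow-false b) (rowOf-restrict (falseAt m) (falseAt-mono m) t b))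
  arrows : ∀ p q → arrowOf (merge m P Q) p q ≡ arrowOf t p q
  arrows p q with side m p | side m q
  ... | inTrue a  | inTrue a'  =
    trans (arrowOf-merge m P Q _ _) (trans (mergeArrow-true a a') (arrowOf-restrict (trueAt m) (trueAt-mono m) t a a'))
  ... | inFalse b | inFalse b' =
    trans (arrowOf-merge m P Q _ _) (trans (mergeArrow-false b b') (arrowOf-restrict (falseAt m) (falseAt-mono m) t b b'))
  ... | inTrue a  | inFalse b  =
    trans (cross-empty m (merge-separated m P Q) (classes-differ m a b))
          (sym (true-false-empty m sep a b))
  ... | inFalse b | inTrue a   =
    trans (cross-empty m (merge-separated m P Q) (classes-differ m a b ∘ sym))
          (sym (false-true-empty m sep b a))

freeRows-merge : ∀ {n} (m : Vec Bool n) (P : AltTableau (trues m)) (Q : AltTableau (falses m)) →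
  freeRows (merge m P Q) ≡ freeRows P + freeRows Q
freeRows-merge m P Q = trans (freeRows-split m (merge m P Q) (merge-separated m P Q))
  (cong₂ _+_ (cong freeRows (restrictTrue-merge m P Q)) (cong freeRows (restrictFalse-merge m P Q)))

freeCols-merge : ∀ {n} (m : Vec Bool n) (P : AltTableau (trues m)) (Q : AltTableau (falses m)) →
  freeCols (merge m P Q) ≡ freeCols P + freeCols Q
freeCols-merge m P Q = trans (freeCols-split m (merge m P Q) (merge-separated m P Q))
  (cong₂ _+_ (cong freeCols (restrictTrue-merge m P Q)) (cong freeCols (restrictFalse-merge m P Q)))

record Consistent {n} (m : Vec Bool n) (t : AltTableau n) : Set where
  field
    separated    : Separated m (arrowOf t)
    freeRowTrue  : ∀ {p} → T (freeRowᵇ t p) → lookup m p ≡ true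
    freeColFalse : ∀ {q} → T (freeColᵇ t q) → lookup m q ≡ false
open Consistent

consistent-trueCols : ∀ {n} {m : Vec Bool n} {t} → Consistent m t → freeCols (restrictTrue m t) ≡ 0
consistent-trueCols {m = m} {t} c = trans (freeCols-count (restrictTrue m t))
  (count-none λ a → trans (sym (freeCol-true m t (separated c) a))
    (false-if-not-T λ free → true≢false (trans (sym (lookup-trueAt m a)) (freeColFalse c free))))

consistent-falseRows : ∀ {n} {m : Vec Bool n} {t} → Consistent m t → freeRows (restrictFalse m t) ≡ 0
consistent-falseRows {m = m} {t} c = trans (freeRows-count (restrictFalse m t))
  (count-none λ b → trans (sym (freeRow-false m t (separated c) b))
    (false-if-not-T λ free → true≢false (trans (sym (freeRowTrue c free)) (lookup-falseAt m b))))

merge-consistent : ∀ {n} (m : Vec Bool n) (P : AltTableau (trues m)) (Q : AltTableau (falses m)) →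
  freeCols P ≡ 0 → freeRows Q ≡ 0 →
  Consistent m (merge m P Q)
merge-consistent {n} m P Q noColsP noRowsQ = record
  { separated = merge-separated m P Q ; freeRowTrue = rowsTrue ; freeColFalse = colsFalse }
  where
  M : AltTableau n
  M = merge m P Q
  rowsTrue : ∀ {p} → T (freeRowᵇ M p) → lookup m p ≡ true
  rowsTrue {p} free with side m p
  ... | inTrue a  = lookup-trueAt m a
  ... | inFalse b = ⊥-elim (subst T noFreeRow free)
    where
    noFreeRow : freeRowᵇ M (falseAt m b) ≡ false
    noFreeRow = trans (freeRow-false m M (merge-separated m P Q) b)
      (trans (cong (λ R → freeRowᵇ R b) (restrictFalse-merge m P Q))
             (count-zero (trans (sym (freeRows-count Q)) noRowsQ) b))
  colsFalse : ∀ {q} → T (freeColᵇ M q) → lookup m q ≡ false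
  colsFalse {q} free with side m q
  ... | inFalse b = lookup-falseAt m b
  ... | inTrue a  = ⊥-elim (subst T noFreeCol free)
    where
    noFreeCol : freeColᵇ M (trueAt m a) ≡ false
    noFreeCol = trans (freeCol-true m M (merge-separated m P Q) a)
      (trans (cong (λ R → freeColᵇ R a) (restrictTrue-merge m P Q))
             (count-zero (trans (sym (freeCols-count P)) noColsP) a))

module _ {n} {σ : Fin n → Bool} {φ : Fin n → Fin n → Arrow} (v : Valid σ φ) where

  leftUnique : ∀ {p q q'} → φ p q ≡ left → φ p q' ≡ left → q ≡ q'
  leftUnique {p} {q} {q'} l l' with FinP.<-cmp q q'
  ... | tri≈ _ q≡q' _ = q≡q'
  ... | tri< q<q' _ _ = ⊥-elim (left-nonempty l' (leftRule v l (arrow⇒cell v (left-nonempty l')) q<q'))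
  ... | tri> _ _ q'<q = ⊥-elim (left-nonempty l (leftRule v l' (arrow⇒cell v (left-nonempty l)) q'<q))

  upUnique : ∀ {p p' q} → φ p q ≡ up → φ p' q ≡ up → p ≡ p'
  upUnique {p} {p'} {q} u u' with FinP.<-cmp p p'
  ... | tri≈ _ p≡p' _ = p≡p'
  ... | tri< p<p' _ _ = ⊥-elim (up-nonempty u (upRule v u' (arrow⇒cell v (up-nonempty u)) p<p'))
  ... | tri> _ _ p'<p = ⊥-elim (up-nonempty u' (upRule v u (arrow⇒cell v (up-nonempty u')) p'<p))

  upAboveLeft : ∀ {r r' q} → φ r q ≡ left → φ r' q ≡ up → r' < r
  upAboveLeft {r} {r'} {q} l u with FinP.<-cmp r' r
  ... | tri< r'<r _ _ = r'<r
  ... | tri≈ _ refl _ with () ← trans (sym l) u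
  ... | tri> _ _ r<r' = ⊥-elim (left-nonempty l (upRule v u (arrow⇒cell v (left-nonempty l)) r<r'))

leftOf : ∀ {n} → (Fin n → Fin n → Arrow) → Fin n → Maybe (Fin n)
leftOf φ r with FinP.any? (λ q → T? (isLeft (φ r q)))
... | yes (q , _) = just q
... | no _        = nothing

upOf : ∀ {n} → (Fin n → Fin n → Arrow) → Fin n → Maybe (Fin n)
upOf φ q with FinP.any? (λ p → T? (isUp (φ p q)))
... | yes (p , _) = just p
... | no _        = nothing

module _ {n} (φ : Fin n → Fin n → Arrow) where

  leftOf-just : ∀ {r q} → leftOf φ r ≡ just q → φ r q ≡ left
  leftOf-just {r} e with FinP.any? (λ q → T? (isLeft (φ r q)))
  leftOf-just {r} refl | yes (q , l) = isLeft⇒ l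

  leftOf-nothing : ∀ {r} → leftOf φ r ≡ nothing → ∀ q → φ r q ≢ left
  leftOf-nothing {r} e q l with FinP.any? (λ q → T? (isLeft (φ r q)))
  leftOf-nothing {r} () q l | yes _
  leftOf-nothing {r} e  q l | no none = none (q , isLeft⇐ l)

  upOf-just : ∀ {q p} → upOf φ q ≡ just p → φ p q ≡ up
  upOf-just {q} e with FinP.any? (λ p → T? (isUp (φ p q)))
  upOf-just {q} refl | yes (p , u) = isUp⇒ u

  upOf-nothing : ∀ {q} → upOf φ q ≡ nothing → ∀ p → φ p q ≢ up
  upOf-nothing {q} e p u with FinP.any? (λ p → T? (isUp (φ p q)))
  upOf-nothing {q} () p u | yes _
  upOf-nothing {q} e  p u | no none = none (p , isUp⇐ u)

  leftOf-none : ∀ {r} → (∀ q → φ r q ≢ left) → leftOf φ r ≡ nothing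
  leftOf-none {r} h with leftOf φ r in e
  ... | just q  = ⊥-elim (h q (leftOf-just e))
  ... | nothing = refl

  upOf-none : ∀ {q} → (∀ p → φ p q ≢ up) → upOf φ q ≡ nothing
  upOf-none {q} h with upOf φ q in e
  ... | just p  = ⊥-elim (h p (upOf-just e))
  ... | nothing = refl

module _ {n} {σ : Fin n → Bool} {φ : Fin n → Fin n → Arrow} (v : Valid σ φ) where

  -- By uniqueness, leftOf and upOf find every left and up arrow.
  leftOf-complete : ∀ {r q} → φ r q ≡ left → leftOf φ r ≡ just q
  leftOf-complete {r} {q} l with leftOf φ r in e
  ... | just q' = cong just (leftUnique v (leftOf-just φ e) l)
  ... | nothing = ⊥-elim (leftOf-nothing φ e q l)

  upOf-complete : ∀ {q p} → φ p q ≡ up → upOf φ q ≡ just p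
  upOf-complete {q} {p} u with upOf φ q in e
  ... | just p' = cong just (upUnique v (upOf-just φ e) u)
  ... | nothing = ⊥-elim (upOf-nothing φ e p u)

module Colouring {n} (t : AltTableau n) where

  private
    σ : Fin n → Bool
    σ = rowOf t
    φ : Fin n → Fin n → Arrow
    φ = arrowOf t
    v : Valid σ φ
    v = validOf t

  -- From a row follow its left arrow to a column, then the up arrow of that
  -- column to a strictly higher row, and so on.  The chain ends in a free
  -- row (colour true) or in a free column (colour false); the fuel k bounds
  -- its length.
  mutual
    fromRow : ℕ → Fin n → Bool
    fromRow zero    r = true
    fromRow (suc k) r = fromLeftOf k (leftOf φ r)

    fromLeftOf : ℕ → Maybe (Fin n) → Bool
    fromLeftOf k nothing  = true
    fromLeftOf k (just q) = fromUpOf k (upOf φ q)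

    fromUpOf : ℕ → Maybe (Fin n) → Bool
    fromUpOf k nothing   = false
    fromUpOf k (just r') = fromRow k r'

  -- Rows strictly decrease along a chain, so any fuel exceeding the
  -- starting row gives the same colour.
  fuel-irrelevant : ∀ k k' r → toℕ r ℕ.< k → toℕ r ℕ.< k' → fromRow k r ≡ fromRow k' r
  fuel-irrelevant (suc k) (suc k') r (s≤s r<k) (s≤s r<k') with leftOf φ r in eL
  ... | nothing = refl
  ... | just q with upOf φ q in eU
  ...   | nothing = refl
  ...   | just r' = fuel-irrelevant k k' r' (ℕP.<-≤-trans r'<r r<k) (ℕP.<-≤-trans r'<r r<k')
    where
    r'<r : r' < r
    r'<r = upAboveLeft v (leftOf-just φ eL) (upOf-just φ eU)

  colour : Fin n → Bool
  colour x = Bool.if σ x then fromRow n x else fromUpOf n (upOf φ x)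

  colouring : Vec Bool n
  colouring = Vec.tabulate colour

  colour-row : ∀ {p} → T (σ p) → colour p ≡ fromRow n p
  colour-row {p} r with σ p
  ... | true = refl

  colour-col : ∀ {q} → T (not (σ q)) → colour q ≡ fromUpOf n (upOf φ q)
  colour-col {q} c with σ q
  ... | false = refl

  fromRow-unfold : ∀ r → fromRow n r ≡ fromLeftOf (ℕ.pred n) (leftOf φ r)
  fromRow-unfold r = go n (FinP.toℕ<n r)
    where
    go : ∀ k → toℕ r ℕ.< k → fromRow k r ≡ fromLeftOf (ℕ.pred k) (leftOf φ r)
    go (suc k) _ = refl

  colour-linked : ∀ {p q} → φ p q ≢ empty → colour p ≡ colour q
  colour-linked {p} {q} ne with arrow⇒cell v ne | φ p q in e
  ... | _ , _ , _       | empty = ⊥-elim (ne e)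
  ... | row , col , _   | up = begin
    colour p                  ≡⟨ colour-row row ⟩
    fromRow n p               ≡⟨ cong (fromUpOf n) (upOf-complete v e) ⟨
    fromUpOf n (upOf φ q)     ≡⟨ colour-col col ⟨
    colour q                  ∎
    where open ≡-Reasoning
  ... | row , col , p<q | left = begin
    colour p                                ≡⟨ colour-row row ⟩
    fromRow n p                             ≡⟨ fromRow-unfold p ⟩
    fromLeftOf (ℕ.pred n) (leftOf φ p)      ≡⟨ cong (fromLeftOf (ℕ.pred n)) (leftOf-complete v e) ⟩
    fromUpOf (ℕ.pred n) (upOf φ q)          ≡⟨ more-fuel (upOf φ q) refl ⟩
    fromUpOf n (upOf φ q)                   ≡⟨ colour-col col ⟨
    colour q                                ∎
    where
    open ≡-Reasoning
    -- the row above the left arrow (p , q) lies above p, hence before n - 1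
    more-fuel : ∀ u → upOf φ q ≡ u → fromUpOf (ℕ.pred n) u ≡ fromUpOf n u
    more-fuel nothing   _  = refl
    more-fuel (just r') eU = fuel-irrelevant (ℕ.pred n) n r'
      (ℕP.<-≤-trans (FinP.<-trans (upAboveLeft v e (upOf-just φ eU)) p<q) (ℕP.<⇒≤pred (FinP.toℕ<n q)))
      (FinP.toℕ<n r')

  -- The colouring is consistent: free rows end their own chain (true),
  -- free columns have no up arrow (false).
  colouring-consistent : Consistent colouring t
  colouring-consistent = record
    { separated    = λ ne → trans (lookup-colouring _) (trans (colour-linked ne) (sym (lookup-colouring _)))
    ; freeRowTrue  = λ {p} free → trans (lookup-colouring p) (begin
        colour p                           ≡⟨ colour-row (∧-fst free) ⟩
        fromRow n p                        ≡⟨ fromRow-unfold p ⟩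
        fromLeftOf (ℕ.pred n) (leftOf φ p) ≡⟨ cong (fromLeftOf (ℕ.pred n))
                                                    (leftOf-none φ (freeRow⇒ {σ = σ} {φ} free)) ⟩
        true                               ∎)
    ; freeColFalse = λ {q} free → trans (lookup-colouring q) (begin
        colour q                           ≡⟨ colour-col (∧-fst free) ⟩
        fromUpOf n (upOf φ q)              ≡⟨ cong (fromUpOf n) (upOf-none φ (freeCol⇒ {σ = σ} {φ} free)) ⟩
        false                              ∎)
    }
    where
    open ≡-Reasoning
    lookup-colouring : ∀ x → lookup colouring x ≡ colour x
    lookup-colouring = VecP.lookup∘tabulate colour

-- Two consistent colourings agree: along a chain the colour is propagated
-- from its end, which is a free row or a free column.
consistent-unique : ∀ {n} {t : AltTableau n} {m m' : Vec Bool n} →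
  Consistent m t → Consistent m' t → m ≡ m'
consistent-unique {n} {t} {m} {m'} c c' = vec-ext agree
  where
  σ : Fin n → Bool
  σ = rowOf t
  φ : Fin n → Fin n → Arrow
  φ = arrowOf t
  v : Valid σ φ
  v = validOf t

  backward : ∀ {p q} → φ p q ≢ empty → lookup m q ≡ lookup m' q → lookup m p ≡ lookup m' p
  backward ne h = trans (separated c ne) (trans h (sym (separated c' ne)))

  forward : ∀ {p q} → φ p q ≢ empty → lookup m p ≡ lookup m' p → lookup m q ≡ lookup m' q
  forward ne h = trans (sym (separated c ne)) (trans h (separated c' ne))

  freeColumn : ∀ {q} → T (not (σ q)) → upOf φ q ≡ nothing → lookup m q ≡ lookup m' q
  freeColumn col eU = let free = freeCol⇐ {σ = σ} {φ} col (upOf-nothing φ eU)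
                      in trans (freeColFalse c free) (sym (freeColFalse c' free))

  agreeRow : ∀ k r → toℕ r ℕ.< k → T (σ r) → lookup m r ≡ lookup m' r
  agreeRow (suc k) r (s≤s r<k) row with leftOf φ r in eL
  ... | nothing = let free = freeRow⇐ {σ = σ} {φ} row (leftOf-nothing φ eL)
                  in trans (freeRowTrue c free) (sym (freeRowTrue c' free))
  ... | just q with upOf φ q in eU
  ...   | nothing = backward l≢empty (freeColumn (proj₁ (proj₂ (arrow⇒cell v l≢empty))) eU)
    where
    l≢empty : φ r q ≢ empty
    l≢empty = left-nonempty (leftOf-just φ eL)
  ...   | just r' = backward l≢empty (forward u≢empty
                      (agreeRow k r' (ℕP.<-≤-trans r'<r r<k) (proj₁ (arrow⇒cell v u≢empty))))
    where
    l≢empty : φ r q ≢ empty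
    l≢empty = left-nonempty (leftOf-just φ eL)
    u≢empty : φ r' q ≢ empty
    u≢empty = up-nonempty (upOf-just φ eU)
    r'<r : r' < r
    r'<r = upAboveLeft v (leftOf-just φ eL) (upOf-just φ eU)

  agree : ∀ x → lookup m x ≡ lookup m' x
  agree x with σ x in eσ
  ... | true = agreeRow n x (FinP.toℕ<n x) (subst T (sym eσ) tt)
  ... | false with upOf φ x in eU
  ...   | nothing = freeColumn (subst (T ∘ not) (sym eσ) tt) eU
  ...   | just r' = forward u≢empty (agreeRow n r' (FinP.toℕ<n r') (proj₁ (arrow⇒cell v u≢empty)))
    where
    u≢empty : φ r' x ≢ empty
    u≢empty = up-nonempty (upOf-just φ eU)

Tableaux : ℕ → ℕ → ℕ → Set
Tableaux i j n = Σ (AltTableau n) λ t → freeRows t ≡ i × freeCols t ≡ j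

-- The counting conditions are propositions, so only the tableau matters.
Tableaux-≡ : ∀ {i j n} {x y : Tableaux i j n} → proj₁ x ≡ proj₁ y → x ≡ y
Tableaux-≡ {x = t , r , c} {.t , r' , c'} refl =
  cong₂ (λ r c → t , r , c) (ℕP.≡-irrelevant r r') (ℕP.≡-irrelevant c c')

Split : ℕ → ℕ → ℕ → Set
Split i j n = Σ (Vec Bool n) λ m → Tableaux i 0 (trues m) × Tableaux 0 j (falses m)

module _ {i j n : ℕ} where

  splitAlong : (m : Vec Bool n) (x : Tableaux i j n) → Consistent m (proj₁ x) → Split i j n
  splitAlong m (t , rows , cols) c =
    m , (restrictTrue m t , rowsP , consistent-trueCols c) , (restrictFalse m t , consistent-falseRows c , colsQ)
    where
    rowsP : freeRows (restrictTrue m t) ≡ i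
    rowsP = begin
      freeRows (restrictTrue m t)                                 ≡⟨ ℕP.+-identityʳ _ ⟨
      freeRows (restrictTrue m t) + 0                             ≡⟨ cong (freeRows (restrictTrue m t) +_)
                                                                          (consistent-falseRows c) ⟨
      freeRows (restrictTrue m t) + freeRows (restrictFalse m t)  ≡⟨ freeRows-split m t (separated c) ⟨
      freeRows t                                                  ≡⟨ rows ⟩
      i                                                           ∎
      where open ≡-Reasoning
    colsQ : freeCols (restrictFalse m t) ≡ j
    colsQ = begin
      freeCols (restrictFalse m t)                                ≡⟨ cong (_+ freeCols (restrictFalse m t))
                                                                          (consistent-trueCols c) ⟨
      freeCols (restrictTrue m t) + freeCols (restrictFalse m t)  ≡⟨ freeCols-split m t (separated c) ⟨
      freeCols t                                                  ≡⟨ cols ⟩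
      j                                                           ∎
      where open ≡-Reasoning

  splitAlong-cong : ∀ {m m'} x (c : Consistent m (proj₁ x)) (c' : Consistent m' (proj₁ x)) →
    m ≡ m' → splitAlong m x c ≡ splitAlong m' x c'
  splitAlong-cong {m} x _ _ refl = cong (m ,_) (cong₂ _,_ (Tableaux-≡ refl) (Tableaux-≡ refl))

  split : Tableaux i j n → Split i j n
  split x = splitAlong (Colouring.colouring (proj₁ x)) x (Colouring.colouring-consistent (proj₁ x))

  glue : Split i j n → Tableaux i j n
  glue (m , (P , rowsP , colsP) , (Q , rowsQ , colsQ)) =
    merge m P Q ,
    trans (freeRows-merge m P Q) (trans (cong₂ _+_ rowsP rowsQ) (ℕP.+-identityʳ i)) ,
    trans (freeCols-merge m P Q) (cong₂ _+_ colsP colsQ)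

  glue-split : ∀ x → glue (split x) ≡ x
  glue-split (t , _ , _) = Tableaux-≡ (merge-restrict (Colouring.colouring t) t
                                         (separated (Colouring.colouring-consistent t)))

  split-glue : ∀ y → split (glue y) ≡ y
  split-glue y@(m , (P , _ , colsP) , (Q , rowsQ , _)) = begin
    split (glue y)                      ≡⟨ splitAlong-cong (glue y) coloured consistent
                                             (consistent-unique coloured consistent) ⟩
    splitAlong m (glue y) consistent    ≡⟨ cong (m ,_) (cong₂ _,_ (Tableaux-≡ (restrictTrue-merge m P Q))
                                                                (Tableaux-≡ (restrictFalse-merge m P Q))) ⟩
    y                                   ∎
    where
    open ≡-Reasoning
    M : AltTableau n
    M = merge m P Q
    coloured : Consistent (Colouring.colouring M) M
    coloured = Colouring.colouring-consistent M
    consistent : Consistent m M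
    consistent = merge-consistent m P Q colsP rowsQ

  decomposition : Tableaux i j n ↔ Split i j n
  decomposition = mk↔ₛ′ split glue split-glue glue-split

∈ᵇ⇒∈ : ∀ x xs → T (x ∈ᵇ xs) → x ∈ xs
∈ᵇ⇒∈ x (y ∷ ys) t with Equivalence.to (BoolP.T-∨ {⌊ x ℤ.≟ y ⌋}) t
... | inj₁ x≡y = here (toWitness {a? = x ℤ.≟ y} x≡y)
... | inj₂ t'  = there (∈ᵇ⇒∈ x ys t')

∈⇒∈ᵇ : ∀ {x xs} → x ∈ xs → T (x ∈ᵇ xs)
∈⇒∈ᵇ {x} {.x ∷ ys} (here refl) =
  Equivalence.from (BoolP.T-∨ {⌊ x ℤ.≟ x ⌋}) (inj₁ (fromWitness {a? = x ℤ.≟ x} refl))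
∈⇒∈ᵇ {x} {y ∷ ys} (there x∈) = Equivalence.from (BoolP.T-∨ {⌊ x ℤ.≟ y ⌋}) (inj₂ (∈⇒∈ᵇ x∈))

Sorted : List ℤ → Set
Sorted = AllPairs ℤ._<_

increasing⇒linked : ∀ L → T (strictlyIncreasing L) → Linked ℤ._<_ L
increasing⇒linked []           _ = []
increasing⇒linked (x ∷ [])     _ = [-]
increasing⇒linked (x ∷ y ∷ ys) t =
  toWitness {a? = x ℤ.<? y} (∧-fst t) ∷ increasing⇒linked (y ∷ ys) (∧-snd {⌊ x ℤ.<? y ⌋} t)

sorted⇒ : ∀ L → T (strictlyIncreasing L) → Sorted L
sorted⇒ L t = LinkedP.Linked⇒AllPairs ℤP.<-trans (increasing⇒linked L t)

sorted⇐ : ∀ {L} → Sorted L → T (strictlyIncreasing L)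
sorted⇐ s = fromLinked (LinkedP.AllPairs⇒Linked s)
  where
  fromLinked : ∀ {L} → Linked ℤ._<_ L → T (strictlyIncreasing L)
  fromLinked []                = tt
  fromLinked [-]               = tt
  fromLinked {x ∷ y ∷ _} (x<y ∷ rest) =
    ∧-intro (fromWitness {a? = x ℤ.<? y} x<y) (fromLinked rest)

below-∉ : ∀ {x xs} → All (x ℤ.<_) xs → x ∉ xs
below-∉ x<xs x∈xs = ℤP.<-irrefl refl (All.lookup x<xs x∈xs)

selectTrue selectFalse : (L : List ℤ) → Vec Bool (length L) → List ℤ
selectTrue []       []          = []
selectTrue (x ∷ xs) (true ∷ m)  = x ∷ selectTrue xs m
selectTrue (x ∷ xs) (false ∷ m) = selectTrue xs m
selectFalse []       []          = []
selectFalse (x ∷ xs) (true ∷ m)  = selectFalse xs m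
selectFalse (x ∷ xs) (false ∷ m) = x ∷ selectFalse xs m

length-selectTrue : ∀ L m → length (selectTrue L m) ≡ trues m
length-selectTrue []       []          = refl
length-selectTrue (x ∷ xs) (true ∷ m)  = cong suc (length-selectTrue xs m)
length-selectTrue (x ∷ xs) (false ∷ m) = length-selectTrue xs m

length-selectFalse : ∀ L m → length (selectFalse L m) ≡ falses m
length-selectFalse []       []          = refl
length-selectFalse (x ∷ xs) (true ∷ m)  = length-selectFalse xs m
length-selectFalse (x ∷ xs) (false ∷ m) = cong suc (length-selectFalse xs m)

All-selectTrue : ∀ {P : ℤ → Set} {L} m → All P L → All P (selectTrue L m)
All-selectTrue {L = []}    []          []       = []
All-selectTrue {L = _ ∷ _} (true ∷ m)  (p ∷ ps) = p ∷ All-selectTrue m ps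
All-selectTrue {L = _ ∷ _} (false ∷ m) (p ∷ ps) = All-selectTrue m ps

All-selectFalse : ∀ {P : ℤ → Set} {L} m → All P L → All P (selectFalse L m)
All-selectFalse {L = []}    []          []       = []
All-selectFalse {L = _ ∷ _} (true ∷ m)  (p ∷ ps) = All-selectFalse m ps
All-selectFalse {L = _ ∷ _} (false ∷ m) (p ∷ ps) = p ∷ All-selectFalse m ps

sorted-selectTrue : ∀ {L} m → Sorted L → Sorted (selectTrue L m)
sorted-selectTrue {[]}    []          []         = []
sorted-selectTrue {_ ∷ _} (true ∷ m)  (h ∷ s)    = All-selectTrue m h ∷ sorted-selectTrue m s
sorted-selectTrue {_ ∷ _} (false ∷ m) (_ ∷ s)    = sorted-selectTrue m s

sorted-selectFalse : ∀ {L} m → Sorted L → Sorted (selectFalse L m)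
sorted-selectFalse {[]}    []          []         = []
sorted-selectFalse {_ ∷ _} (true ∷ m)  (_ ∷ s)    = sorted-selectFalse m s
sorted-selectFalse {_ ∷ _} (false ∷ m) (h ∷ s)    = All-selectFalse m h ∷ sorted-selectFalse m s

∈-selectTrue : ∀ {x} L m → x ∈ selectTrue L m → x ∈ L
∈-selectTrue []       []          ()
∈-selectTrue (y ∷ ys) (true ∷ m)  (here e)  = here e
∈-selectTrue (y ∷ ys) (true ∷ m)  (there i) = there (∈-selectTrue ys m i)
∈-selectTrue (y ∷ ys) (false ∷ m) i         = there (∈-selectTrue ys m i)

∈-selectFalse : ∀ {x} L m → x ∈ selectFalse L m → x ∈ L
∈-selectFalse []       []          ()
∈-selectFalse (y ∷ ys) (false ∷ m) (here e)  = here e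
∈-selectFalse (y ∷ ys) (false ∷ m) (there i) = there (∈-selectFalse ys m i)
∈-selectFalse (y ∷ ys) (true ∷ m)  i         = there (∈-selectFalse ys m i)

∈-select : ∀ {x} L m → x ∈ L → x ∈ selectTrue L m ⊎ x ∈ selectFalse L m
∈-select (y ∷ ys) (true ∷ m)  (here e)  = inj₁ (here e)
∈-select (y ∷ ys) (false ∷ m) (here e)  = inj₂ (here e)
∈-select (y ∷ ys) (true ∷ m)  (there i) = Sum.map₁ there (∈-select ys m i)
∈-select (y ∷ ys) (false ∷ m) (there i) = Sum.map₂ there (∈-select ys m i)

select-disjoint : ∀ {x L} m → Sorted L → x ∈ selectTrue L m → x ∉ selectFalse L m
select-disjoint {L = []} [] [] ()
select-disjoint {L = y ∷ ys} (true ∷ m)  (h ∷ s) (here refl) = below-∉ (All-selectFalse m h)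
select-disjoint {L = y ∷ ys} (true ∷ m)  (h ∷ s) (there i)   = select-disjoint m s i
select-disjoint {L = y ∷ ys} (false ∷ m) (h ∷ s) i (here refl) = below-∉ h (∈-selectTrue ys m i)
select-disjoint {L = y ∷ ys} (false ∷ m) (h ∷ s) i (there j)   = select-disjoint m s i j

maskOf : (ℤ → Bool) → (L : List ℤ) → Vec Bool (length L)
maskOf p []       = []
maskOf p (x ∷ xs) = p x ∷ maskOf p xs

maskOf-cong : ∀ {p q : ℤ → Bool} L → (∀ {x} → x ∈ L → p x ≡ q x) → maskOf p L ≡ maskOf q L
maskOf-cong []       h = refl
maskOf-cong (x ∷ xs) h = cong₂ _∷_ (h (here refl)) (maskOf-cong xs (h ∘ there))

selectFalse-maskOf : ∀ (p : ℤ → Bool) L → selectFalse L (maskOf p L) ≡ selectTrue L (maskOf (not ∘ p) L)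
selectFalse-maskOf p []       = refl
selectFalse-maskOf p (x ∷ xs) with p x
... | true  = selectFalse-maskOf p xs
... | false = cong (x ∷_) (selectFalse-maskOf p xs)

∈ᵇ-skip : ∀ {z x S} → z ≢ x → (z ∈ᵇ (x ∷ S)) ≡ (z ∈ᵇ S)
∈ᵇ-skip {z} {x} {S} z≢x = T-ext {z ∈ᵇ (x ∷ S)} {z ∈ᵇ S}
  (λ t → ∈⇒∈ᵇ (drop (∈ᵇ⇒∈ z (x ∷ S) t))) (λ t → ∈⇒∈ᵇ (there (∈ᵇ⇒∈ z S t)))
  where
  drop : z ∈ x ∷ S → z ∈ S
  drop (here z≡x) = ⊥-elim (z≢x z≡x)
  drop (there i)  = i

-- Marking the labels of a selection recovers the mask (labels are distinct).
maskOf-selectTrue : ∀ {L} m → Sorted L → maskOf (_∈ᵇ selectTrue L m) L ≡ m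
maskOf-selectTrue {[]}     []          []      = refl
maskOf-selectTrue {x ∷ xs} (true ∷ m)  (h ∷ s) = cong₂ _∷_
  (Equivalence.to (BoolP.T-≡ {x ∈ᵇ (x ∷ selectTrue xs m)}) (∈⇒∈ᵇ {xs = x ∷ selectTrue xs m} (here refl)))
  (trans (maskOf-cong xs (λ {z} z∈ → ∈ᵇ-skip {z} {x} {selectTrue xs m} (λ { refl → below-∉ h z∈ })))
         (maskOf-selectTrue m s))
maskOf-selectTrue {x ∷ xs} (false ∷ m) (h ∷ s) = cong₂ _∷_
  (false-if-not-T {x ∈ᵇ selectTrue xs m} (below-∉ (All-selectTrue m h) ∘ ∈ᵇ⇒∈ x (selectTrue xs m)))
  (maskOf-selectTrue m s)

selectTrue-maskOf : ∀ {L S} → Sorted L → Sorted S → (∀ {x} → x ∈ S → x ∈ L) →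
  selectTrue L (maskOf (_∈ᵇ S) L) ≡ S
selectTrue-maskOf {[]}     {[]}    _ _ _ = refl
selectTrue-maskOf {[]}     {y ∷ _} _ _ sub with () ← sub (here refl)
selectTrue-maskOf {x ∷ xs} {[]}    (_ ∷ s) [] _ = selectTrue-maskOf s [] (λ ())
selectTrue-maskOf {x ∷ xs} {y ∷ S'} (h ∷ s) (hS ∷ sS') sub with x ∈ᵇ (y ∷ S') in e
... | false = selectTrue-maskOf s (hS ∷ sS') λ z∈ → inTail (sub z∈) λ { refl → subst T e (∈⇒∈ᵇ z∈) }
  where
  inTail : ∀ {z} → z ∈ x ∷ xs → z ≢ x → z ∈ xs
  inTail (here z≡x) z≢x = ⊥-elim (z≢x z≡x)
  inTail (there i)  _   = i
... | true with head-agrees (sub (here refl)) (∈ᵇ⇒∈ x (y ∷ S') (subst T (sym e) tt))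
  where
  head-agrees : y ∈ x ∷ xs → x ∈ y ∷ S' → y ≡ x
  head-agrees (here y≡x) _          = y≡x
  head-agrees (there y∈) (here x≡y) = sym x≡y
  head-agrees (there y∈) (there x∈) = ⊥-elim (ℤP.<-asym (All.lookup h y∈) (All.lookup hS x∈))
...   | refl = cong (x ∷_) (trans
          (cong (selectTrue xs) (maskOf-cong xs λ {z} z∈ → ∈ᵇ-skip {z} {x} {S'} λ { refl → below-∉ h z∈ }))
          (selectTrue-maskOf s sS' (λ z∈ → inTail (sub (there z∈)) (All.lookup hS z∈))))
  where
  inTail : ∀ {z} → z ∈ x ∷ xs → x ℤ.< z → z ∈ xs
  inTail (here refl) x<x = ⊥-elim (ℤP.<-irrefl refl x<x)
  inTail (there i)   _   = i

record DisjointUnion (LP LQ L : List ℤ) : Set where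
  field
    disjoint : ∀ {x} → x ∈ LP → x ∉ LQ
    leftIn   : ∀ {x} → x ∈ LP → x ∈ L
    rightIn  : ∀ {x} → x ∈ LQ → x ∈ L
    covers   : ∀ {x} → x ∈ L → x ∈ LP ⊎ x ∈ LQ
open DisjointUnion

allᵇ-elim : ∀ {p : ℤ → Bool} {xs} → T (all p xs) → ∀ {x} → x ∈ xs → T (p x)
allᵇ-elim {p} {xs} t = All.lookup (AllP.all⁺ p xs t)

allᵇ-intro : ∀ {p : ℤ → Bool} {xs} → (∀ {x} → x ∈ xs → T (p x)) → T (all p xs)
allᵇ-intro {p} h = AllP.all⁻ p (All.tabulate h)

disjointUnion⇒ : ∀ LP LQ L → T (disjointUnionᵇ LP LQ L) → DisjointUnion LP LQ L
disjointUnion⇒ LP LQ L t with Equivalence.to BoolP.T-∧ t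
... | d , t₁ with Equivalence.to BoolP.T-∧ t₁
...   | l , t₂ with Equivalence.to BoolP.T-∧ t₂
...     | r , c = record
  { disjoint = λ {x} x∈P x∈Q → T-not⇒¬ (allᵇ-elim d x∈P) (∈⇒∈ᵇ x∈Q)
  ; leftIn   = λ {x} x∈P → ∈ᵇ⇒∈ x L (allᵇ-elim l x∈P)
  ; rightIn  = λ {x} x∈Q → ∈ᵇ⇒∈ x L (allᵇ-elim r x∈Q)
  ; covers   = λ {x} x∈L → Sum.map (∈ᵇ⇒∈ x LP) (∈ᵇ⇒∈ x LQ)
                             (Equivalence.to BoolP.T-∨ (allᵇ-elim {λ x → (x ∈ᵇ LP) ∨ (x ∈ᵇ LQ)} c x∈L))
  }

disjointUnion⇐ : ∀ {LP LQ L} → DisjointUnion LP LQ L → T (disjointUnionᵇ LP LQ L)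
disjointUnion⇐ {LP} {LQ} {L} u =
  ∧-intro (allᵇ-intro (λ {x} x∈P → ¬⇒T-not {x ∈ᵇ LQ} (disjoint u x∈P ∘ ∈ᵇ⇒∈ x LQ)))
  (∧-intro (allᵇ-intro (λ x∈P → ∈⇒∈ᵇ (leftIn u x∈P)))
  (∧-intro (allᵇ-intro (λ x∈Q → ∈⇒∈ᵇ (rightIn u x∈Q)))
           (allᵇ-intro (λ {x} x∈L → Equivalence.from (BoolP.T-∨ {x ∈ᵇ LP})
                                       (Sum.map ∈⇒∈ᵇ ∈⇒∈ᵇ (covers u x∈L))))))

select-disjointUnion : ∀ {L} m → Sorted L → DisjointUnion (selectTrue L m) (selectFalse L m) L
select-disjointUnion {L} m s = record
  { disjoint = select-disjoint m s
  ; leftIn   = ∈-selectTrue L m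
  ; rightIn  = ∈-selectFalse L m
  ; covers   = ∈-select L m
  }

LabelSplit : List ℤ → Set
LabelSplit L = Σ (List ℤ × List ℤ) λ LPQ →
  T (strictlyIncreasing (proj₁ LPQ)) × T (strictlyIncreasing (proj₂ LPQ)) ×
  T (disjointUnionᵇ (proj₁ LPQ) (proj₂ LPQ) L)

LabelSplit-≡ : ∀ L {x y : LabelSplit L} → proj₁ x ≡ proj₁ y → x ≡ y
LabelSplit-≡ L {x = LPQ , iP , iQ , u} {.LPQ , iP' , iQ' , u'} refl =
  cong₂ (λ a b → LPQ , a , b) (BoolP.T-irrelevant iP iP')
    (cong₂ _,_ (BoolP.T-irrelevant iQ iQ') (BoolP.T-irrelevant u u'))

masks↔labelSplits : ∀ L → T (strictlyIncreasing L) → Vec Bool (length L) ↔ LabelSplit L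
masks↔labelSplits L incL = mk↔ₛ′ select mark select-mark mark-select
  where
  sL : Sorted L
  sL = sorted⇒ L incL
  select : Vec Bool (length L) → LabelSplit L
  select m = (selectTrue L m , selectFalse L m) ,
             sorted⇐ (sorted-selectTrue m sL) , sorted⇐ (sorted-selectFalse m sL) ,
             disjointUnion⇐ (select-disjointUnion m sL)
  mark : LabelSplit L → Vec Bool (length L)
  mark ((LP , LQ) , _) = maskOf (_∈ᵇ LP) L
  mark-select : ∀ m → mark (select m) ≡ m
  mark-select m = maskOf-selectTrue m sL
  select-mark : ∀ x → select (mark x) ≡ x
  select-mark ((LP , LQ) , iP , iQ , t) = LabelSplit-≡ L (cong₂ _,_
    (selectTrue-maskOf sL (sorted⇒ LP iP) (leftIn u))
    (begin
      selectFalse L (maskOf (_∈ᵇ LP) L)              ≡⟨ selectFalse-maskOf (_∈ᵇ LP) L ⟩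
      selectTrue L (maskOf (not ∘ (_∈ᵇ LP)) L)       ≡⟨ cong (selectTrue L) (maskOf-cong L complement) ⟩
      selectTrue L (maskOf (_∈ᵇ LQ) L)               ≡⟨ selectTrue-maskOf sL (sorted⇒ LQ iQ) (rightIn u) ⟩
      LQ                                             ∎))
    where
    open ≡-Reasoning
    u : DisjointUnion LP LQ L
    u = disjointUnion⇒ LP LQ L t
    complement : ∀ {x} → x ∈ L → not (x ∈ᵇ LP) ≡ (x ∈ᵇ LQ)
    complement {x} x∈L = T-ext {not (x ∈ᵇ LP)} {x ∈ᵇ LQ}
      (λ notP → Sum.[ (λ x∈P → ⊥-elim (T-not⇒¬ notP (∈⇒∈ᵇ x∈P))) , ∈⇒∈ᵇ ] (covers u x∈L))
      (λ inQ → ¬⇒T-not (λ inP → disjoint u (∈ᵇ⇒∈ x LP inP) (∈ᵇ⇒∈ x LQ inQ)))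

cast↔ : ∀ {F : ℕ → Set} {a b} → a ≡ b → F a ↔ F b
cast↔ refl = ↔-refl

sameList⇒≡ : ∀ L' L → T (sameList L' L) → L' ≡ L
sameList⇒≡ []       []       _ = refl
sameList⇒≡ (x ∷ xs) (y ∷ ys) t =
  cong₂ _∷_ (toWitness {a? = x ℤ.≟ y} (∧-fst t)) (sameList⇒≡ xs ys (∧-snd {⌊ x ℤ.≟ y ⌋} t))

sameList-refl : ∀ L → T (sameList L L)
sameList-refl []       = tt
sameList-refl (x ∷ xs) = ∧-intro (fromWitness {a? = x ℤ.≟ x} refl) (sameList-refl xs)

Σ-T-≡ : ∀ {A : Set} {P : A → Bool} {a b : A} {pa : T (P a)} {pb : T (P b)} →
  a ≡ b → _≡_ {A = Σ A (λ x → T (P x))} (a , pa) (b , pb)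
Σ-T-≡ refl = cong (_ ,_) (BoolP.T-irrelevant _ _)

-- A tableau in A_{i,j}(n) labeled by L is just a tableau of length |L|:
-- its label set is forced to be L.
labeled↔unlabeled : ∀ i j n L → length L ≡ n → T (strictlyIncreasing L) →
  LabeledA i j n L ↔ Tableaux i j (length L)
labeled↔unlabeled i j n L lenL incL = mk↔ₛ′ forget label forget-label label-forget
  where
  forget : LabeledA i j n L → Tableaux i j (length L)
  forget (labeledAltTableau L' _ t , c) =
    subst (Tableaux i j) (cong length (sameList⇒≡ L' L (∧-fst c)))
      (t , toWitness {a? = freeRows t ℕ.≟ i} (∧-fst counts) , toWitness {a? = freeCols t ℕ.≟ j} (∧-snd counts))
    where
    counts : T (⌊ freeRows t ℕ.≟ i ⌋ ∧ ⌊ freeCols t ℕ.≟ j ⌋)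
    counts = ∧-snd {⌊ length L' ℕ.≟ n ⌋} (∧-snd {sameList L' L} c)

  label : Tableaux i j (length L) → LabeledA i j n L
  label (t , rows , cols) = labeledAltTableau L incL t ,
    ∧-intro (sameList-refl L) (∧-intro (fromWitness {a? = length L ℕ.≟ n} lenL)
      (∧-intro (fromWitness {a? = freeRows t ℕ.≟ i} rows) (fromWitness {a? = freeCols t ℕ.≟ j} cols)))

  forget-label : ∀ y → forget (label y) ≡ y
  forget-label (t , _) = trans (subst-id _ _) (Tableaux-≡ refl)
    where
    subst-id : ∀ {k} (e : k ≡ k) (x : Tableaux i j k) → subst (Tableaux i j) e x ≡ x
    subst-id e x = cong (λ e → subst (Tableaux i j) e x) (ℕP.≡-irrelevant e refl)

  label-subst : ∀ {L'} (e : L' ≡ L) inc t {x : Tableaux i j (length L')} → proj₁ x ≡ t →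
    proj₁ (label (subst (Tableaux i j) (cong length e) x)) ≡ labeledAltTableau L' inc t
  label-subst refl inc t refl = cong (λ inc → labeledAltTableau L inc t) (BoolP.T-irrelevant incL inc)

  label-forget : ∀ x → label (forget x) ≡ x
  label-forget (labeledAltTableau L' inc t , c) = Σ-T-≡ (label-subst (sameList⇒≡ L' L (∧-fst c)) inc t refl)

Pieces : ℕ → ℕ → (L : List ℤ) → LabelSplit L → Set
Pieces i j L s = Tableaux i 0 (length (proj₁ (proj₁ s))) × Tableaux 0 j (length (proj₂ (proj₁ s)))

pieces↔pairs : ∀ i j L → Σ (LabelSplit L) (Pieces i j L) ↔ PairsPQ i j L
pieces↔pairs i j L = mk↔ₛ′ pair unpair pair-unpair unpair-pair
  where
  pair : Σ (LabelSplit L) (Pieces i j L) → PairsPQ i j L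
  pair (((LP , LQ) , iP , iQ , u) , (tP , rowsP , colsP) , (tQ , rowsQ , colsQ)) =
    (labeledAltTableau LP iP tP , labeledAltTableau LQ iQ tQ) ,
    ∧-intro (fromWitness {a? = freeRows tP ℕ.≟ i} rowsP)
    (∧-intro (fromWitness {a? = freeCols tP ℕ.≟ 0} colsP)
    (∧-intro (fromWitness {a? = freeRows tQ ℕ.≟ 0} rowsQ)
    (∧-intro (fromWitness {a? = freeCols tQ ℕ.≟ j} colsQ) u)))

  unpair : PairsPQ i j L → Σ (LabelSplit L) (Pieces i j L)
  unpair ((labeledAltTableau LP iP tP , labeledAltTableau LQ iQ tQ) , c) =
    ((LP , LQ) , iP , iQ , ∧-snd {⌊ freeCols tQ ℕ.≟ j ⌋} c₃) ,
    (tP , toWitness {a? = freeRows tP ℕ.≟ i} (∧-fst c) , toWitness {a? = freeCols tP ℕ.≟ 0} (∧-fst c₁)) ,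
    (tQ , toWitness {a? = freeRows tQ ℕ.≟ 0} (∧-fst c₂) , toWitness {a? = freeCols tQ ℕ.≟ j} (∧-fst c₃))
    where
    c₁ : T (⌊ freeCols tP ℕ.≟ 0 ⌋ ∧ ⌊ freeRows tQ ℕ.≟ 0 ⌋ ∧ ⌊ freeCols tQ ℕ.≟ j ⌋ ∧
            disjointUnionᵇ LP LQ L)
    c₁ = ∧-snd {⌊ freeRows tP ℕ.≟ i ⌋} c
    c₂ : T (⌊ freeRows tQ ℕ.≟ 0 ⌋ ∧ ⌊ freeCols tQ ℕ.≟ j ⌋ ∧ disjointUnionᵇ LP LQ L)
    c₂ = ∧-snd {⌊ freeCols tP ℕ.≟ 0 ⌋} c₁
    c₃ : T (⌊ freeCols tQ ℕ.≟ j ⌋ ∧ disjointUnionᵇ LP LQ L)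
    c₃ = ∧-snd {⌊ freeRows tQ ℕ.≟ 0 ⌋} c₂

  pair-unpair : ∀ y → pair (unpair y) ≡ y
  pair-unpair ((labeledAltTableau _ _ _ , labeledAltTableau _ _ _) , _) = Σ-T-≡ refl

  -- the remaining components are proofs of Boolean conditions or of ℕ equalities
  unpair-pair : ∀ x → unpair (pair x) ≡ x
  unpair-pair (((LP , LQ) , iP , iQ , u) , (tP , _) , (tQ , _)) =
    cong₂ (λ u' pieces → ((LP , LQ) , iP , iQ , u') , pieces)
      (BoolP.T-irrelevant _ u) (cong₂ _,_ (Tableaux-≡ refl) (Tableaux-≡ refl))

corollary2p15 : (i j n : ℕ) (L : List ℤ) →
    length L ≡ n → T (strictlyIncreasing L) →
    LabeledA i j n L ↔ PairsPQ i j L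
corollary2p15 i j n L lenL incL = begin
  LabeledA i j n L                 ↔⟨ labeled↔unlabeled i j n L lenL incL ⟩
  Tableaux i j (length L)          ↔⟨ decomposition ⟩
  Split i j (length L)             ↔⟨ Σ-↔ (masks↔labelSplits L incL) attachLabels ⟩
  Σ (LabelSplit L) (Pieces i j L)  ↔⟨ pieces↔pairs i j L ⟩
  PairsPQ i j L                    ∎
  where
  open Related.EquationalReasoning
  attachLabels : ∀ {m} → (Tableaux i 0 (trues m) × Tableaux 0 j (falses m)) ↔
                    (Tableaux i 0 (length (selectTrue L m)) × Tableaux 0 j (length (selectFalse L m)))
  attachLabels {m} = cast↔ {Tableaux i 0} (sym (length-selectTrue L m))
                 ×-↔ cast↔ {Tableaux 0 j} (sym (length-selectFalse L m))
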